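{- $ILL\leq_m ATile$.
   Context: $\varphi_e$ denotes the $e$-th partial computable function; $\leq_m$ is many-one reducibility. A tree is a subset of $\omega^{<\omega}$ (strings coded as numbers) closed under initial segments; $ILL=\{e:\varphi_e$ is the characteristic function of a tree $T\subseteq\omega^{<\omega}$ with an infinite path$\}$. A Wang prototile is a 4-tuple $\langle l,u,r,b\rangle$ of colours (natural numbers) for left, upper, right, bottom quarters; prototile sets are identified with sets of codes. A total $S$-tiling is a map $T:\mathbb{Z}^2\to S$ with right colour of $T(x,y)$ = left colour of $T(x+1,y)$ and upper colour of $T(x,y)$ = bottom colour of $T(x,y+1)$ (no rotations); it is periodic if $T(p+\mathbf v)=T(p)$ for all $p$ for some nonzero $\mathbf v\in\mathbb{Z}^2$, aperiodic otherwise. $ATile=\{e:\varphi_e$ is the characteristic function of a set $S$ of Wang prototiles which has at least one total $S$-tiling and all of whose total tilings are aperiodic$\}$. -}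

module Defs where

open import Data.Nat using (ℕ; zero; suc; _+_; _*_; _∸_; _^_)
open import Data.Fin using (Fin; toℕ)
open import Data.Vec using (Vec; []; _∷_; lookup)
open import Data.List using (List; []; _∷_; applyUpTo)
open import Data.List.Relation.Binary.Prefix.Heterogeneous using (Prefix)
open import Data.Integer as ℤ using (ℤ)
open import Data.Product using (Σ; _×_; _,_)
open import Data.Sum using (_⊎_)
open import Relation.Nullary using (¬_)
open import Relation.Binary.PropositionalEquality using (_≡_)
open import Function.Bundles using (_⇔_)

⟪_,_⟫ : ℕ → ℕ → ℕ
⟪ a , b ⟫ = (2 ^ a) * (2 * b + 1) ∸ 1

data PR : ℕ → Set where
  Z    : ∀ {n} → PR n
  S    : PR 1
  P    : ∀ {n} → Fin n → PR n
  comp : ∀ {m n} → PR m → Vec (PR n) m → PR n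
  prim : ∀ {n} → PR n → PR (suc (suc n)) → PR (suc n)
  mu   : ∀ {n} → PR (suc n) → PR n

mutual
  data _[_]⇓_ : ∀ {n} → PR n → Vec ℕ n → ℕ → Set where
    ⇓Z    : ∀ {n} {xs : Vec ℕ n} → Z [ xs ]⇓ 0
    ⇓S    : ∀ {x} → S [ x ∷ [] ]⇓ suc x
    ⇓P    : ∀ {n} {i : Fin n} {xs} → P i [ xs ]⇓ lookup xs i
    ⇓comp : ∀ {m n} {f : PR m} {gs : Vec (PR n) m} {xs ys y} →
            gs [ xs ]⇓* ys → f [ ys ]⇓ y → comp f gs [ xs ]⇓ y
    ⇓prim0 : ∀ {n} {g : PR n} {h} {xs y} →
             g [ xs ]⇓ y → prim g h [ 0 ∷ xs ]⇓ y
    ⇓primS : ∀ {n} {g : PR n} {h} {k xs r y} →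
             prim g h [ k ∷ xs ]⇓ r → h [ k ∷ r ∷ xs ]⇓ y →
             prim g h [ suc k ∷ xs ]⇓ y
    ⇓mu   : ∀ {n} {f : PR (suc n)} {xs y} → MuFrom f xs 0 y → mu f [ xs ]⇓ y

  data _[_]⇓*_ : ∀ {m n} → Vec (PR n) m → Vec ℕ n → Vec ℕ m → Set where
    []  : ∀ {n} {xs : Vec ℕ n} → [] [ xs ]⇓* []
    _∷_ : ∀ {m n} {g : PR n} {gs : Vec (PR n) m} {xs y ys} →
          g [ xs ]⇓ y → gs [ xs ]⇓* ys → (g ∷ gs) [ xs ]⇓* (y ∷ ys)

  data MuFrom {n} (f : PR (suc n)) (xs : Vec ℕ n) : ℕ → ℕ → Set where
    here  : ∀ {k} → f [ k ∷ xs ]⇓ 0 → MuFrom f xs k k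
    there : ∀ {k v y} → f [ k ∷ xs ]⇓ suc v → MuFrom f xs (suc k) y →
            MuFrom f xs k y

-- Gödel numbering of terms (injective for each fixed arity)
mutual
  encode : ∀ {n} → PR n → ℕ
  encode Z                  = ⟪ 0 , 0 ⟫
  encode S                  = ⟪ 1 , 0 ⟫
  encode (P i)              = ⟪ 2 , toℕ i ⟫
  encode (comp {m} f gs)    = ⟪ 3 , ⟪ m , ⟪ encode f , encodeVec gs ⟫ ⟫ ⟫
  encode (prim g h)         = ⟪ 4 , ⟪ encode g , encode h ⟫ ⟫
  encode (mu f)             = ⟪ 5 , encode f ⟫

  encodeVec : ∀ {m n} → Vec (PR n) m → ℕ
  encodeVec []       = 0
  encodeVec (g ∷ gs) = suc ⟪ encode g , encodeVec gs ⟫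

-- φ e x ⇓ y : "φ_e(x) is defined and equals y".  e is the code of a unary
-- term; numbers that code no unary term index the nowhere-defined function.
_·_⇓_ : ℕ → ℕ → ℕ → Set
e · x ⇓ y = Σ (PR 1) λ c → encode c ≡ e × c [ x ∷ [] ]⇓ y

IsCharFn : ℕ → Set
IsCharFn e = ∀ x → (e · x ⇓ 0) ⊎ (e · x ⇓ 1)

_∋ₑ_ : ℕ → ℕ → Set
e ∋ₑ x = e · x ⇓ 1

⌜_⌝ : List ℕ → ℕ
⌜ [] ⌝    = 0
⌜ a ∷ s ⌝ = suc ⟪ a , ⌜ s ⌝ ⟫

IsTree : ℕ → Set
IsTree e = ∀ s t → Prefix _≡_ t s → e ∋ₑ ⌜ s ⌝ → e ∋ₑ ⌜ t ⌝

HasInfinitePath : ℕ → Set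
HasInfinitePath e = Σ (ℕ → ℕ) λ f → ∀ n → e ∋ₑ ⌜ applyUpTo f n ⌝

ILL : ℕ → Set
ILL e = IsCharFn e × IsTree e × HasInfinitePath e

record Tile : Set where
  constructor ⟨_,_,_,_⟩
  field
    left upper right bottom : ℕ
open Tile public

⌜_⌝ᵗ : Tile → ℕ
⌜ ⟨ l , u , r , b ⟩ ⌝ᵗ = ⟪ l , ⟪ u , ⟪ r , b ⟫ ⟫ ⟫

IsTiling : ℕ → (ℤ → ℤ → Tile) → Set
IsTiling e τ = ∀ x y →
  (e ∋ₑ ⌜ τ x y ⌝ᵗ) ×
  (right (τ x y) ≡ left (τ (x ℤ.+ ℤ.1ℤ) y)) ×
  (upper (τ x y) ≡ bottom (τ x (y ℤ.+ ℤ.1ℤ)))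

Periodic : (ℤ → ℤ → Tile) → Set
Periodic τ = Σ ℤ λ v₁ → Σ ℤ λ v₂ → ¬ (v₁ ≡ ℤ.0ℤ × v₂ ≡ ℤ.0ℤ) ×
  (∀ x y → τ (x ℤ.+ v₁) (y ℤ.+ v₂) ≡ τ x y)

ATile : ℕ → Set
ATile e = IsCharFn e ×
          (Σ (ℤ → ℤ → Tile) λ τ → IsTiling e τ) ×
          (∀ τ → IsTiling e τ → ¬ Periodic τ)

_≤ₘ_ : (ℕ → Set) → (ℕ → Set) → Set
A ≤ₘ B = Σ (ℕ → ℕ) λ f →
  (Σ ℕ λ i → ∀ n → i · n ⇓ f n) ×
  (∀ e → A e ⇔ B (f e))

-- From e we compute the code of a program deciding a set of Wang prototiles whose tilings carry
-- integer coordinates in their colours: horizontal colours hold a column index that grows by one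
-- to the right, and vertical colours hold, on the rows y ≥ 0, a string of the tree that grows by
-- one letter per row, and on the rows y < 0 a counter that reaches the empty string at row 0.
-- These coordinates rule out every nonzero period.  A path of the tree yields a tiling in which
-- every column spells the path; conversely, in any tiling, column 0 spells an infinite path from
-- the row holding the empty string upwards.  The program also queries φ_e at its input x and at x
-- without its last letter, and answers neither 0 nor 1 unless these answers look like those of
-- the characteristic function of a tree; hence the tile set has a characteristic function exactly
-- when φ_e is the characteristic function of a tree.

module Submission where

open import Defs

module Pairing where

  open import Data.Nat
  open import Data.Nat.Properties
  open import Data.Nat.Induction using (<-rec)
  open import Data.Product using (Σ; _×_; _,_; proj₁; proj₂)
  open import Data.Sum using (_⊎_; inj₁; inj₂)
  open import Data.Empty using (⊥-elim)
  open import Relation.Binary.PropositionalEquality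

  even⊎odd : ∀ n → Σ ℕ λ k → n ≡ 2 * k ⊎ n ≡ suc (2 * k)
  even⊎odd zero = 0 , inj₁ refl
  even⊎odd (suc n) with even⊎odd n
  ... | k , inj₁ n≡2k  = k , inj₂ (cong suc n≡2k)
  ... | k , inj₂ n≡2k+1 = suc k , inj₁ (cong suc (trans n≡2k+1 (sym (+-suc k (k + 0)))))

  ⌈_,_⌉ : ℕ → ℕ → ℕ
  ⌈ a , b ⌉ = 2 ^ a * (2 * b + 1)

  ⌈0,_⌉ : ∀ b → ⌈ 0 , b ⌉ ≡ suc (2 * b)
  ⌈0, b ⌉ = trans (+-identityʳ (2 * b + 1)) (+-comm (2 * b) 1)

  ⌈suc,⌉ : ∀ a b → ⌈ suc a , b ⌉ ≡ 2 * ⌈ a , b ⌉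
  ⌈suc,⌉ a b = *-assoc 2 (2 ^ a) (2 * b + 1)

  ⌈⌉-injective : ∀ {a b c d} → ⌈ a , b ⌉ ≡ ⌈ c , d ⌉ → a ≡ c × b ≡ d
  ⌈⌉-injective {zero} {b} {zero} {d} eq =
    refl , *-cancelˡ-≡ b d 2 (suc-injective (trans (sym ⌈0, b ⌉) (trans eq ⌈0, d ⌉)))
  ⌈⌉-injective {zero} {b} {suc c} {d} eq =
    ⊥-elim (even≢odd ⌈ c , d ⌉ b (sym (trans (sym ⌈0, b ⌉) (trans eq (⌈suc,⌉ c d)))))
  ⌈⌉-injective {suc a} {b} {zero} {d} eq =
    ⊥-elim (even≢odd ⌈ a , b ⌉ d (trans (sym (⌈suc,⌉ a b)) (trans eq ⌈0, d ⌉)))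
  ⌈⌉-injective {suc a} {b} {suc c} {d} eq
    with refl , refl ← ⌈⌉-injective {a} {b} {c} {d}
           (*-cancelˡ-≡ _ _ 2 (trans (sym (⌈suc,⌉ a b)) (trans eq (⌈suc,⌉ c d))))
    = refl , refl

  ⌈⌉-surjective : ∀ n → Σ ℕ λ a → Σ ℕ λ b → ⌈ a , b ⌉ ≡ suc n
  ⌈⌉-surjective = <-rec _ λ n rec → halve n rec (even⊎odd (suc n))
    where
    halve : ∀ n → (∀ {m} → m < n → Σ ℕ λ a → Σ ℕ λ b → ⌈ a , b ⌉ ≡ suc m) →
            (Σ ℕ λ k → suc n ≡ 2 * k ⊎ suc n ≡ suc (2 * k)) →
            Σ ℕ λ a → Σ ℕ λ b → ⌈ a , b ⌉ ≡ suc n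
    halve n rec (k , inj₂ odd) = 0 , k , trans ⌈0, k ⌉ (sym odd)
    halve n rec (suc k , inj₁ even)
      with a , b , eq ← rec (subst (k <_) (sym (suc-injective even)) (m<m+n k z<s))
      = suc a , b , trans (⌈suc,⌉ a b) (trans (cong (2 *_) eq) (sym even))

  suc-⟪⟫ : ∀ a b → suc ⟪ a , b ⟫ ≡ ⌈ a , b ⌉
  suc-⟪⟫ a b = m+[n∸m]≡n (*-mono-≤ (m^n>0 2 a) (m≤n+m 1 (2 * b)))

  ⟪⟫-injective : ∀ a b c d → ⟪ a , b ⟫ ≡ ⟪ c , d ⟫ → a ≡ c × b ≡ d
  ⟪⟫-injective a b c d eq =
    ⌈⌉-injective (trans (sym (suc-⟪⟫ a b)) (trans (cong suc eq) (suc-⟪⟫ c d)))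

  ⟪0,⟫≢⟪1,⟫ : ∀ m n → ⟪ 0 , m ⟫ ≢ ⟪ 1 , n ⟫
  ⟪0,⟫≢⟪1,⟫ m n eq with () ← proj₁ (⟪⟫-injective 0 m 1 n eq)

  ⟪⟫-surjective : ∀ n → Σ ℕ λ a → Σ ℕ λ b → ⟪ a , b ⟫ ≡ n
  ⟪⟫-surjective n with a , b , eq ← ⌈⌉-surjective n =
    a , b , suc-injective (trans (suc-⟪⟫ a b) eq)

  opaque
    fst snd : ℕ → ℕ
    fst n = proj₁ (⟪⟫-surjective n)
    snd n = proj₁ (proj₂ (⟪⟫-surjective n))

    ⟪fst,snd⟫ : ∀ n → ⟪ fst n , snd n ⟫ ≡ n
    ⟪fst,snd⟫ n = proj₂ (proj₂ (⟪⟫-surjective n))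

  fst-⟪⟫ : ∀ a b → fst ⟪ a , b ⟫ ≡ a
  fst-⟪⟫ a b = proj₁ (⟪⟫-injective (fst ⟪ a , b ⟫) (snd ⟪ a , b ⟫) a b (⟪fst,snd⟫ ⟪ a , b ⟫))

  snd-⟪⟫ : ∀ a b → snd ⟪ a , b ⟫ ≡ b
  snd-⟪⟫ a b = proj₂ (⟪⟫-injective (fst ⟪ a , b ⟫) (snd ⟪ a , b ⟫) a b (⟪fst,snd⟫ ⟪ a , b ⟫))

  fst-snd⇒≡⟪⟫ : ∀ {n a b} → fst n ≡ a → snd n ≡ b → n ≡ ⟪ a , b ⟫
  fst-snd⇒≡⟪⟫ {n} refl refl = sym (⟪fst,snd⟫ n)

  ≤⟪,⟫ : ∀ a b → b ≤ ⟪ a , b ⟫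
  ≤⟪,⟫ a b = ≤-pred (begin
    suc b               ≤⟨ s≤s (m≤m+n b (b + 0)) ⟩
    suc (2 * b)         ≡⟨ ⌈0, b ⌉ ⟨
    ⌈ 0 , b ⌉           ≤⟨ *-monoˡ-≤ (2 * b + 1) (m^n>0 2 a) ⟩
    ⌈ a , b ⌉           ≡⟨ suc-⟪⟫ a b ⟨
    suc ⟪ a , b ⟫       ∎)
    where open ≤-Reasoning

  snd≤ : ∀ n → snd n ≤ n
  snd≤ n = subst (snd n ≤_) (⟪fst,snd⟫ n) (≤⟪,⟫ (fst n) (snd n))

module Programs where

  open Pairing
  open import Data.Nat
  open import Data.Nat.Properties
  open import Data.Fin using (Fin; toℕ) renaming (zero to fzero; suc to fsuc)
  open import Data.Fin.Properties using (toℕ-injective)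
  open import Data.Vec using (Vec; []; _∷_)
  open import Data.Product using (Σ; _×_; _,_)
  open import Relation.Binary.PropositionalEquality
  open import Relation.Nullary using (contradiction)
  open import Function using (_⇔_; mk⇔)

  Computes₁ : PR 1 → (ℕ → ℕ) → Set
  Computes₁ t f = ∀ a → t [ a ∷ [] ]⇓ f a

  Computes₂ : PR 2 → (ℕ → ℕ → ℕ) → Set
  Computes₂ t f = ∀ a b → t [ a ∷ b ∷ [] ]⇓ f a b

  Computes₃ : PR 3 → (ℕ → ℕ → ℕ → ℕ) → Set
  Computes₃ t f = ∀ a b c → t [ a ∷ b ∷ c ∷ [] ]⇓ f a b c

  π₀ : ∀ {n} → PR (1 + n)
  π₀ = P fzero

  π₁ : ∀ {n} → PR (2 + n)
  π₁ = P (fsuc fzero)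

  π₂ : ∀ {n} → PR (3 + n)
  π₂ = P (fsuc (fsuc fzero))

  π₃ : ∀ {n} → PR (4 + n)
  π₃ = P (fsuc (fsuc (fsuc fzero)))

  infixr 9 _∙_

  _∙_ : ∀ {n} → PR 1 → PR n → PR n
  f ∙ g = comp f (g ∷ [])

  comp₂ : ∀ {n} → PR 2 → PR n → PR n → PR n
  comp₂ f g h = comp f (g ∷ h ∷ [])

  comp₃ : ∀ {n} → PR 3 → PR n → PR n → PR n → PR n
  comp₃ f g h k = comp f (g ∷ h ∷ k ∷ [])

  constᴾ : ∀ {n} → ℕ → PR n
  constᴾ zero    = Z
  constᴾ (suc k) = S ∙ constᴾ k

  module _ {n} {xs : Vec ℕ n} where

    ⇓-resp-≡ : ∀ {t y y′} → y ≡ y′ → t [ xs ]⇓ y → t [ xs ]⇓ y′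
    ⇓-resp-≡ refl t⇓ = t⇓

    ∙-⇓ : ∀ {f g y z} → g [ xs ]⇓ y → f [ y ∷ [] ]⇓ z → (f ∙ g) [ xs ]⇓ z
    ∙-⇓ g⇓ f⇓ = ⇓comp (g⇓ ∷ []) f⇓

    infixr 9 _∙⇓_

    _∙⇓_ : ∀ {f F g y} → Computes₁ f F → g [ xs ]⇓ y → (f ∙ g) [ xs ]⇓ F y
    f⇓ ∙⇓ g⇓ = ∙-⇓ g⇓ (f⇓ _)

    comp₂⇓ : ∀ {f g h y₁ y₂ z} → g [ xs ]⇓ y₁ → h [ xs ]⇓ y₂ → f [ y₁ ∷ y₂ ∷ [] ]⇓ z →
             comp₂ f g h [ xs ]⇓ z
    comp₂⇓ g⇓ h⇓ f⇓ = ⇓comp (g⇓ ∷ h⇓ ∷ []) f⇓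

    comp₃⇓ : ∀ {f g h k y₁ y₂ y₃ z} → g [ xs ]⇓ y₁ → h [ xs ]⇓ y₂ → k [ xs ]⇓ y₃ →
             f [ y₁ ∷ y₂ ∷ y₃ ∷ [] ]⇓ z → comp₃ f g h k [ xs ]⇓ z
    comp₃⇓ g⇓ h⇓ k⇓ f⇓ = ⇓comp (g⇓ ∷ h⇓ ∷ k⇓ ∷ []) f⇓

    constᴾ⇓ : ∀ k → constᴾ k [ xs ]⇓ k
    constᴾ⇓ zero    = ⇓Z
    constᴾ⇓ (suc k) = ∙-⇓ (constᴾ⇓ k) ⇓S

  S⇓ : Computes₁ S suc
  S⇓ _ = ⇓S

  predᴾ : PR 1
  predᴾ = prim Z π₀

  predᴾ⇓ : Computes₁ predᴾ pred
  predᴾ⇓ zero    = ⇓prim0 ⇓Z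
  predᴾ⇓ (suc a) = ⇓primS (predᴾ⇓ a) ⇓P

  private
    addᴾ : PR 2
    addᴾ = prim π₀ (S ∙ π₁)

    addᴾ⇓ : Computes₂ addᴾ _+_
    addᴾ⇓ zero    b = ⇓prim0 ⇓P
    addᴾ⇓ (suc a) b = ⇓primS (addᴾ⇓ a b) (S⇓ ∙⇓ ⇓P)

    mulᴾ : PR 2
    mulᴾ = prim Z (comp₂ addᴾ π₂ π₁)

    mulᴾ⇓ : Computes₂ mulᴾ _*_
    mulᴾ⇓ zero    b = ⇓prim0 ⇓Z
    mulᴾ⇓ (suc a) b = ⇓primS (mulᴾ⇓ a b) (comp₂⇓ ⇓P ⇓P (addᴾ⇓ b (a * b)))

    -- prim recurses on its first argument, so the subtrahend comes first
    flippedMonusᴾ : PR 2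
    flippedMonusᴾ = prim π₀ (predᴾ ∙ π₁)

    flippedMonusᴾ⇓ : Computes₂ flippedMonusᴾ (λ b a → a ∸ b)
    flippedMonusᴾ⇓ zero    a = ⇓prim0 ⇓P
    flippedMonusᴾ⇓ (suc b) a = ⇓primS (flippedMonusᴾ⇓ b a)
      (⇓-resp-≡ (pred[m∸n]≡m∸[1+n] a b) (predᴾ⇓ ∙⇓ ⇓P))

  infixl 6 _+ᴾ_ _∸ᴾ_
  infixl 7 _*ᴾ_

  _+ᴾ_ _*ᴾ_ _∸ᴾ_ : ∀ {n} → PR n → PR n → PR n
  f +ᴾ g = comp₂ addᴾ f g
  f *ᴾ g = comp₂ mulᴾ f g
  f ∸ᴾ g = comp₂ flippedMonusᴾ g f

  module _ {n} {xs : Vec ℕ n} {f g : PR n} {a b : ℕ} where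

    infixl 6 _+⇓_ _∸⇓_
    infixl 7 _*⇓_

    _+⇓_ : f [ xs ]⇓ a → g [ xs ]⇓ b → (f +ᴾ g) [ xs ]⇓ (a + b)
    f⇓ +⇓ g⇓ = comp₂⇓ f⇓ g⇓ (addᴾ⇓ a b)

    _*⇓_ : f [ xs ]⇓ a → g [ xs ]⇓ b → (f *ᴾ g) [ xs ]⇓ (a * b)
    f⇓ *⇓ g⇓ = comp₂⇓ f⇓ g⇓ (mulᴾ⇓ a b)

    _∸⇓_ : f [ xs ]⇓ a → g [ xs ]⇓ b → (f ∸ᴾ g) [ xs ]⇓ (a ∸ b)
    f⇓ ∸⇓ g⇓ = comp₂⇓ g⇓ f⇓ (flippedMonusᴾ⇓ b a)

  private
    pow2ᴾ : PR 1
    pow2ᴾ = prim (constᴾ 1) (constᴾ 2 *ᴾ π₁)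

    pow2ᴾ⇓ : Computes₁ pow2ᴾ (2 ^_)
    pow2ᴾ⇓ zero    = ⇓prim0 (constᴾ⇓ 1)
    pow2ᴾ⇓ (suc a) = ⇓primS (pow2ᴾ⇓ a) (constᴾ⇓ 2 *⇓ ⇓P)

    pairᴾ : PR 2
    pairᴾ = pow2ᴾ ∙ π₀ *ᴾ (constᴾ 2 *ᴾ π₁ +ᴾ constᴾ 1) ∸ᴾ constᴾ 1

    pairᴾ⇓ : Computes₂ pairᴾ ⟪_,_⟫
    pairᴾ⇓ a b = pow2ᴾ⇓ ∙⇓ ⇓P *⇓ (constᴾ⇓ 2 *⇓ ⇓P +⇓ constᴾ⇓ 1) ∸⇓ constᴾ⇓ 1

  ∸+∸≡∣-∣ : ∀ m n → (m ∸ n) + (n ∸ m) ≡ ∣ m - n ∣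
  ∸+∸≡∣-∣ zero    zero    = refl
  ∸+∸≡∣-∣ zero    (suc n) = refl
  ∸+∸≡∣-∣ (suc m) zero    = +-identityʳ (suc m)
  ∸+∸≡∣-∣ (suc m) (suc n) = ∸+∸≡∣-∣ m n

  ⟪_,_⟫ᴾ ∣_-ᴾ_∣ : ∀ {n} → PR n → PR n → PR n
  ⟪ f , g ⟫ᴾ = comp₂ pairᴾ f g
  ∣ f -ᴾ g ∣ = (f ∸ᴾ g) +ᴾ (g ∸ᴾ f)

  module _ {n} {xs : Vec ℕ n} {f g : PR n} {a b : ℕ} where

    ⟪_,_⟫⇓ : f [ xs ]⇓ a → g [ xs ]⇓ b → ⟪ f , g ⟫ᴾ [ xs ]⇓ ⟪ a , b ⟫
    ⟪ f⇓ , g⇓ ⟫⇓ = comp₂⇓ f⇓ g⇓ (pairᴾ⇓ a b)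

    ∣_-⇓_∣ : f [ xs ]⇓ a → g [ xs ]⇓ b → ∣ f -ᴾ g ∣ [ xs ]⇓ ∣ a - b ∣
    ∣ f⇓ -⇓ g⇓ ∣ = ⇓-resp-≡ (∸+∸≡∣-∣ a b) ((f⇓ ∸⇓ g⇓) +⇓ (g⇓ ∸⇓ f⇓))

  caseℕ : ℕ → ℕ → ℕ → ℕ
  caseℕ zero    z s = z
  caseℕ (suc _) z s = s

  caseᴾ : ∀ {n} → PR n → PR n → PR n → PR n
  caseᴾ = comp₃ (prim π₀ π₃)

  caseᴾ⇓ : ∀ {n} {xs : Vec ℕ n} {c z s a b d} →
           c [ xs ]⇓ a → z [ xs ]⇓ b → s [ xs ]⇓ d → caseᴾ c z s [ xs ]⇓ caseℕ a b d
  caseᴾ⇓ c⇓ z⇓ s⇓ = comp₃⇓ c⇓ z⇓ s⇓ (by-cases _ _ _)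
    where
    by-cases : Computes₃ (prim π₀ π₃) caseℕ
    by-cases zero    z s = ⇓prim0 ⇓P
    by-cases (suc c) z s = ⇓primS (by-cases c z s) ⇓P

  mu⇓ : ∀ {n} {f : PR (suc n)} {xs : Vec ℕ n} (F : ℕ → ℕ) {y} →
        (∀ k → f [ k ∷ xs ]⇓ F k) → F y ≡ 0 → (∀ {k} → k < y → F k ≢ 0) →
        mu f [ xs ]⇓ y
  mu⇓ {f = f} {xs} F {y} f⇓ Fy≡0 F≢0 = ⇓mu (search 0 y refl)
    where
    search : ∀ k d → k + d ≡ y → MuFrom f xs k y
    search k zero    k+0≡y with refl ← trans (sym (+-identityʳ k)) k+0≡y =
      here (⇓-resp-≡ Fy≡0 (f⇓ k))
    search k (suc d) k+d≡y with F k in Fk≡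
    ... | zero  = contradiction Fk≡ (F≢0 (subst (k <_) k+d≡y (m<m+n k z<s)))
    ... | suc _ = there (⇓-resp-≡ Fk≡ (f⇓ k)) (search (suc k) d (trans (sym (+-suc k d)) k+d≡y))

  mutual
    ⇓-deterministic : ∀ {n} {t : PR n} {xs y y′} → t [ xs ]⇓ y → t [ xs ]⇓ y′ → y ≡ y′
    ⇓-deterministic ⇓Z ⇓Z = refl
    ⇓-deterministic ⇓S ⇓S = refl
    ⇓-deterministic ⇓P ⇓P = refl
    ⇓-deterministic (⇓comp gs⇓ f⇓) (⇓comp gs⇓′ f⇓′)
      with refl ← ⇓*-deterministic gs⇓ gs⇓′ = ⇓-deterministic f⇓ f⇓′
    ⇓-deterministic (⇓prim0 g⇓) (⇓prim0 g⇓′) = ⇓-deterministic g⇓ g⇓′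
    ⇓-deterministic (⇓primS r⇓ h⇓) (⇓primS r⇓′ h⇓′)
      with refl ← ⇓-deterministic r⇓ r⇓′ = ⇓-deterministic h⇓ h⇓′
    ⇓-deterministic (⇓mu m) (⇓mu m′) = MuFrom-deterministic m m′

    ⇓*-deterministic : ∀ {m n} {gs : Vec (PR n) m} {xs ys ys′} →
                       gs [ xs ]⇓* ys → gs [ xs ]⇓* ys′ → ys ≡ ys′
    ⇓*-deterministic []         []           = refl
    ⇓*-deterministic (g⇓ ∷ gs⇓) (g⇓′ ∷ gs⇓′) =
      cong₂ _∷_ (⇓-deterministic g⇓ g⇓′) (⇓*-deterministic gs⇓ gs⇓′)

    MuFrom-deterministic : ∀ {n} {f : PR (suc n)} {xs k y y′} →
                           MuFrom f xs k y → MuFrom f xs k y′ → y ≡ y′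
    MuFrom-deterministic (here _)     (here _)      = refl
    MuFrom-deterministic (here f⇓)    (there f⇓′ _) with () ← ⇓-deterministic f⇓ f⇓′
    MuFrom-deterministic (there f⇓ _) (here f⇓′)    with () ← ⇓-deterministic f⇓ f⇓′
    MuFrom-deterministic (there _ m)  (there _ m′)  = MuFrom-deterministic m m′

  compCode : ℕ → ℕ → ℕ → ℕ
  compCode m f gs = ⟪ 3 , ⟪ m , ⟪ f , gs ⟫ ⟫ ⟫

  consCode : ℕ → ℕ → ℕ
  consCode g gs = suc ⟪ g , gs ⟫

  private
    tag : ∀ {n} → PR n → ℕ
    tag Z          = 0
    tag S          = 1
    tag (P _)      = 2
    tag (comp _ _) = 3
    tag (prim _ _) = 4
    tag (mu _)     = 5

    body : ∀ {n} → PR n → ℕ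
    body Z               = 0
    body S               = 0
    body (P i)           = toℕ i
    body (comp {m} f gs) = ⟪ m , ⟪ encode f , encodeVec gs ⟫ ⟫
    body (prim g h)      = ⟪ encode g , encode h ⟫
    body (mu f)          = encode f

    encode≡⟪tag,body⟫ : ∀ {n} (t : PR n) → encode t ≡ ⟪ tag t , body t ⟫
    encode≡⟪tag,body⟫ Z          = refl
    encode≡⟪tag,body⟫ S          = refl
    encode≡⟪tag,body⟫ (P _)      = refl
    encode≡⟪tag,body⟫ (comp _ _) = refl
    encode≡⟪tag,body⟫ (prim _ _) = refl
    encode≡⟪tag,body⟫ (mu _)     = refl

    data Tagged : ∀ {n} → ℕ → PR n → Set where
      Z-tagged    : ∀ {n} → Tagged {n} 0 Z
      S-tagged    : Tagged 1 S
      P-tagged    : ∀ {n} {i : Fin n} → Tagged 2 (P i)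
      comp-tagged : ∀ {m n} {f : PR m} {gs : Vec (PR n) m} → Tagged 3 (comp f gs)
      prim-tagged : ∀ {n} {g : PR n} {h} → Tagged 4 (prim g h)
      mu-tagged   : ∀ {n} {f : PR (suc n)} → Tagged 5 (mu f)

    -- Seeing a term through its tag lets unification discard all pairs of distinct constructors.
    tagged : ∀ {n k} (t : PR n) → tag t ≡ k → Tagged k t
    tagged Z          refl = Z-tagged
    tagged S          refl = S-tagged
    tagged (P _)      refl = P-tagged
    tagged (comp _ _) refl = comp-tagged
    tagged (prim _ _) refl = prim-tagged
    tagged (mu _)     refl = mu-tagged

    encode≡⟪⟫ : ∀ {n} (t : PR n) {k b} → encode t ≡ ⟪ k , b ⟫ → Tagged k t × body t ≡ b
    encode≡⟪⟫ t {k} {b} eq =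
      let tag≡ , body≡ = ⟪⟫-injective (tag t) (body t) k b (trans (sym (encode≡⟪tag,body⟫ t)) eq)
      in tagged t tag≡ , body≡

  mutual
    encode-injective : ∀ {n} (s t : PR n) → encode s ≡ encode t → s ≡ t
    encode-injective s t eq = same-body s (encode≡⟪⟫ t (trans (sym eq) (encode≡⟪tag,body⟫ s)))

    encodeVec-injective : ∀ {m n} (gs hs : Vec (PR n) m) → encodeVec gs ≡ encodeVec hs → gs ≡ hs
    encodeVec-injective []       []       _  = refl
    encodeVec-injective (g ∷ gs) (h ∷ hs) eq
      with g≡h , gs≡hs ← ⟪⟫-injective (encode g) (encodeVec gs) (encode h) (encodeVec hs) (suc-injective eq)
      with refl ← encode-injective g h g≡h
         | refl ← encodeVec-injective gs hs gs≡hs = refl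

    private
      same-body : ∀ {n} (s : PR n) {t} → Tagged (tag s) t × body t ≡ body s → s ≡ t
      same-body Z     (Z-tagged , _) = refl
      same-body S     (S-tagged , _) = refl
      same-body (P i) (P-tagged {i = j} , j≡i) = cong P (toℕ-injective (sym j≡i))
      same-body (comp {m} f gs) (comp-tagged {m = m′} {f = f′} {gs′} , eq)
        with refl , eq′ ← ⟪⟫-injective m′ ⟪ encode f′ , encodeVec gs′ ⟫ m ⟪ encode f , encodeVec gs ⟫ eq
        with f≡ , gs≡ ← ⟪⟫-injective (encode f) (encodeVec gs) (encode f′) (encodeVec gs′) (sym eq′)
        with refl ← encode-injective f f′ f≡
           | refl ← encodeVec-injective gs gs′ gs≡ = refl
      same-body (prim g h) (prim-tagged {g = g′} {h′} , eq)
        with g≡ , h≡ ← ⟪⟫-injective (encode g) (encode h) (encode g′) (encode h′) (sym eq)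
        with refl ← encode-injective g g′ g≡
           | refl ← encode-injective h h′ h≡ = refl
      same-body (mu f) (mu-tagged {f = f′} , eq) with refl ← encode-injective f f′ (sym eq) = refl

  encode-comp⁻¹ : ∀ {n m} (t : PR n) {a b} → encode t ≡ compCode m a b →
                  Σ (PR m) λ f → Σ (Vec (PR n) m) λ gs → encode f ≡ a × encodeVec gs ≡ b
  encode-comp⁻¹ {m = m} t {a} {b} eq with encode≡⟪⟫ t {3} {⟪ m , ⟪ a , b ⟫ ⟫} eq
  ... | comp-tagged {m = m′} {f = f} {gs} , eq′
    with refl , eq″ ← ⟪⟫-injective m′ ⟪ encode f , encodeVec gs ⟫ m ⟪ a , b ⟫ eq′ =
    f , gs , ⟪⟫-injective (encode f) (encodeVec gs) a b eq″

  encodeVec-cons⁻¹ : ∀ {m n} (gs : Vec (PR n) (suc m)) {a b} → encodeVec gs ≡ consCode a b →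
                     Σ (PR n) λ g → Σ (Vec (PR n) m) λ hs → encode g ≡ a × encodeVec hs ≡ b
  encodeVec-cons⁻¹ (g ∷ gs) {a} {b} eq = g , gs , ⟪⟫-injective (encode g) (encodeVec gs) a b (suc-injective eq)

  module _ {n : ℕ} where

    compCodeᴾ : ℕ → PR n → PR n → PR n
    compCodeᴾ m f gs = ⟪ constᴾ 3 , ⟪ constᴾ m , ⟪ f , gs ⟫ᴾ ⟫ᴾ ⟫ᴾ

    consCodeᴾ : PR n → PR n → PR n
    consCodeᴾ g gs = S ∙ ⟪ g , gs ⟫ᴾ

    compCodeᴾ⇓ : ∀ {xs : Vec ℕ n} m {f gs a b} → f [ xs ]⇓ a → gs [ xs ]⇓ b →
                 compCodeᴾ m f gs [ xs ]⇓ compCode m a b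
    compCodeᴾ⇓ m f⇓ gs⇓ = ⟪ constᴾ⇓ 3 , ⟪ constᴾ⇓ m , ⟪ f⇓ , gs⇓ ⟫⇓ ⟫⇓ ⟫⇓

    consCodeᴾ⇓ : ∀ {xs : Vec ℕ n} {g gs a b} → g [ xs ]⇓ a → gs [ xs ]⇓ b →
                 consCodeᴾ g gs [ xs ]⇓ consCode a b
    consCodeᴾ⇓ g⇓ gs⇓ = S⇓ ∙⇓ ⟪ g⇓ , gs⇓ ⟫⇓

  ·⇓⇔ : ∀ c {e x y} → encode c ≡ e → (e · x ⇓ y) ⇔ (c [ x ∷ [] ]⇓ y)
  ·⇓⇔ c {x = x} {y} c-code = mk⇔
    (λ (c′ , c′-code , c′⇓) →
       subst (λ t → t [ x ∷ [] ]⇓ y) (encode-injective c′ c (trans c′-code (sym c-code))) c′⇓)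
    (λ c⇓ → c , c-code , c⇓)

module StringCodes where

  open Pairing
  open Programs
  open import Data.Nat
  open import Data.Nat.Properties
  open import Data.Nat.Induction using (<-rec)
  open import Data.Nat.GeneralisedArithmetic using (fold; iterate; iterate-is-fold)
  open import Data.List using (List; []; _∷_; _∷ʳ_; _ʳ++_; reverse; drop; length; initLast; _∷ʳ′_)
  open import Data.List.Properties using (reverse-++; reverse-involutive)
  open import Data.Vec using ([]; _∷_)
  open import Data.Product using (Σ; _,_; proj₁; proj₂)
  open import Data.Sum using (_⊎_; inj₁; inj₂)
  open import Relation.Binary.PropositionalEquality

  private
    misses : ℕ → ℕ → ℕ → ℕ
    misses zero    a x = 1
    misses (suc k) a x = misses k a x * ∣ ⟪ a , k ⟫ - x ∣

    missesᴾ : PR 3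
    missesᴾ = prim (constᴾ 1) (π₁ *ᴾ ∣ ⟪ π₂ , π₀ ⟫ᴾ -ᴾ π₃ ∣)

    missesᴾ⇓ : Computes₃ missesᴾ misses
    missesᴾ⇓ zero    a x = ⇓prim0 (constᴾ⇓ 1)
    missesᴾ⇓ (suc k) a x = ⇓primS (missesᴾ⇓ k a x) (⇓P *⇓ ∣ ⟪ ⇓P , ⇓P ⟫⇓ -⇓ ⇓P ∣)

    misses≡0 : ∀ {k a x b} → b < k → ⟪ a , b ⟫ ≡ x → misses k a x ≡ 0
    misses≡0 {suc k} {a} {x} b<1+k ⟪a,b⟫≡x with m≤n⇒m<n∨m≡n (s≤s⁻¹ b<1+k)
    ... | inj₁ b<k  = cong (_* ∣ ⟪ a , k ⟫ - x ∣) (misses≡0 b<k ⟪a,b⟫≡x)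
    ... | inj₂ refl = trans (cong (misses k a x *_) (m≡n⇒∣m-n∣≡0 ⟪a,b⟫≡x)) (*-zeroʳ (misses k a x))

    misses≢0 : ∀ {k a x} → (∀ {b} → b < k → ⟪ a , b ⟫ ≢ x) → misses k a x ≢ 0
    misses≢0 {suc k} {a} {x} miss eq with m*n≡0⇒m≡0∨n≡0 (misses k a x) eq
    ... | inj₁ eq′ = misses≢0 (λ b<k → miss (m<n⇒m<1+n b<k)) eq′
    ... | inj₂ eq′ = miss ≤-refl (∣m-n∣≡0⇒m≡n eq′)

  -- fst x is the least a such that ⟪ a , b ⟫ ≡ x for some b ≤ x.
  fstᴾ : PR 1
  fstᴾ = mu (comp₃ missesᴾ (S ∙ π₁) π₀ π₁)

  fstᴾ⇓ : Computes₁ fstᴾ fst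
  fstᴾ⇓ x = mu⇓ (λ a → misses (suc x) a x)
    (λ a → comp₃⇓ (S⇓ ∙⇓ ⇓P) ⇓P ⇓P (missesᴾ⇓ (suc x) a x))
    (misses≡0 (s≤s (snd≤ x)) (⟪fst,snd⟫ x))
    (λ {a} a<fst → misses≢0 {suc x} {a} {x} λ {b} _ ⟪a,b⟫≡x →
       <⇒≢ a<fst (trans (sym (fst-⟪⟫ a b)) (cong fst ⟪a,b⟫≡x)))

  sndᴾ : PR 1
  sndᴾ = mu ∣ ⟪ fstᴾ ∙ π₁ , π₀ ⟫ᴾ -ᴾ π₁ ∣

  sndᴾ⇓ : Computes₁ sndᴾ snd
  sndᴾ⇓ x = mu⇓ (λ b → ∣ ⟪ fst x , b ⟫ - x ∣)
    (λ b → ∣ ⟪ fstᴾ⇓ ∙⇓ ⇓P , ⇓P ⟫⇓ -⇓ ⇓P ∣)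
    (m≡n⇒∣m-n∣≡0 (⟪fst,snd⟫ x))
    (λ {b} b<snd eq → <⇒≢ b<snd (trans (sym (snd-⟪⟫ (fst x) b)) (cong snd (∣m-n∣≡0⇒m≡n eq))))

  ⌜⌝-injective : ∀ s t → ⌜ s ⌝ ≡ ⌜ t ⌝ → s ≡ t
  ⌜⌝-injective []      []      _  = refl
  ⌜⌝-injective (a ∷ s) (b ∷ t) eq
    with refl , eq′ ← ⟪⟫-injective a ⌜ s ⌝ b ⌜ t ⌝ (suc-injective eq) =
    cong (a ∷_) (⌜⌝-injective s t eq′)

  ⌜⌝-surjective : ∀ n → Σ (List ℕ) λ s → ⌜ s ⌝ ≡ n
  ⌜⌝-surjective = <-rec _ λ where
    zero    _   → [] , refl
    (suc w) rec → let s , ⌜s⌝≡ = rec (s≤s (snd≤ w)) in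
      fst w ∷ s , cong suc (trans (cong ⟪ fst w ,_⟫ ⌜s⌝≡) (⟪fst,snd⟫ w))

  decode : ℕ → List ℕ
  decode n = proj₁ (⌜⌝-surjective n)

  ⌜decode⌝ : ∀ n → ⌜ decode n ⌝ ≡ n
  ⌜decode⌝ n = proj₂ (⌜⌝-surjective n)

  decode-⌜⌝ : ∀ s → decode ⌜ s ⌝ ≡ s
  decode-⌜⌝ s = ⌜⌝-injective _ s (⌜decode⌝ ⌜ s ⌝)

  ⌜⌝-initLast : ∀ n → n ≡ ⌜ [] ⌝ ⊎ Σ (List ℕ) λ s → Σ ℕ λ a → n ≡ ⌜ s ∷ʳ a ⌝
  ⌜⌝-initLast n = view (decode n) (⌜decode⌝ n)
    where
    view : ∀ s → ⌜ s ⌝ ≡ n → n ≡ ⌜ [] ⌝ ⊎ Σ (List ℕ) λ s → Σ ℕ λ a → n ≡ ⌜ s ∷ʳ a ⌝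
    view s ⌜s⌝≡n with initLast s
    ... | []       = inj₁ (sym ⌜s⌝≡n)
    ... | s′ ∷ʳ′ a = inj₂ (s′ , a , sym ⌜s⌝≡n)

  ⌜∷ʳ⌝>0 : ∀ s a → 0 < ⌜ s ∷ʳ a ⌝
  ⌜∷ʳ⌝>0 []      a = z<s
  ⌜∷ʳ⌝>0 (_ ∷ _) a = z<s

  length≤⌜⌝ : ∀ s → length s ≤ ⌜ s ⌝
  length≤⌜⌝ []      = z≤n
  length≤⌜⌝ (a ∷ s) = s≤s (≤-trans (length≤⌜⌝ s) (≤⟪,⟫ a ⌜ s ⌝))

  tailCode : ℕ → ℕ
  tailCode n = snd (pred n)

  tailCode-⌜⌝ : ∀ s → tailCode ⌜ s ⌝ ≡ ⌜ drop 1 s ⌝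
  tailCode-⌜⌝ []      = snd-⟪⟫ 0 0
  tailCode-⌜⌝ (a ∷ s) = snd-⟪⟫ a ⌜ s ⌝

  moveHead : ℕ → ℕ → ℕ
  moveHead acc rest = caseℕ rest ⟪ acc , 0 ⟫ ⟪ consCode (fst (pred rest)) acc , snd (pred rest) ⟫

  reverseStep : ℕ → ℕ
  reverseStep st = moveHead (fst st) (snd st)

  reverseCode : ℕ → ℕ
  reverseCode n = fst (iterate reverseStep ⟪ 0 , n ⟫ n)

  iterate-fixed : ∀ {A : Set} {f : A → A} {x} → f x ≡ x → ∀ k → iterate f x k ≡ x
  iterate-fixed fx≡x zero    = refl
  iterate-fixed {f = f} fx≡x (suc k) = trans (cong (λ y → iterate f y k) fx≡x) (iterate-fixed fx≡x k)

  reverseStep-⟪⟫ : ∀ a b → reverseStep ⟪ a , b ⟫ ≡ moveHead a b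
  reverseStep-⟪⟫ a b = cong₂ moveHead (fst-⟪⟫ a b) (snd-⟪⟫ a b)

  reverseStep-∷ : ∀ acc a r → reverseStep ⟪ ⌜ acc ⌝ , ⌜ a ∷ r ⌝ ⟫ ≡ ⟪ ⌜ a ∷ acc ⌝ , ⌜ r ⌝ ⟫
  reverseStep-∷ acc a r = trans (reverseStep-⟪⟫ ⌜ acc ⌝ ⌜ a ∷ r ⌝)
    (cong₂ (λ a′ r′ → ⟪ consCode a′ ⌜ acc ⌝ , r′ ⟫) (fst-⟪⟫ a ⌜ r ⌝) (snd-⟪⟫ a ⌜ r ⌝))

  iterate-reverseStep : ∀ k acc r → length r ≤ k →
                        iterate reverseStep ⟪ ⌜ acc ⌝ , ⌜ r ⌝ ⟫ k ≡ ⟪ ⌜ r ʳ++ acc ⌝ , 0 ⟫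
  iterate-reverseStep k       acc []      _ = iterate-fixed (reverseStep-⟪⟫ ⌜ acc ⌝ 0) k
  iterate-reverseStep (suc k) acc (a ∷ r) (s≤s |r|≤k) =
    trans (cong (λ st → iterate reverseStep st k) (reverseStep-∷ acc a r))
          (iterate-reverseStep k (a ∷ acc) r |r|≤k)

  reverseCode-⌜⌝ : ∀ s → reverseCode ⌜ s ⌝ ≡ ⌜ reverse s ⌝
  reverseCode-⌜⌝ s = trans (cong fst (iterate-reverseStep ⌜ s ⌝ [] s (length≤⌜⌝ s))) (fst-⟪⟫ _ 0)

  dropLastCode : ℕ → ℕ
  dropLastCode n = reverseCode (tailCode (reverseCode n))

  dropLastCode-⌜⌝ : ∀ s → dropLastCode ⌜ s ⌝ ≡ ⌜ reverse (drop 1 (reverse s)) ⌝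
  dropLastCode-⌜⌝ s rewrite reverseCode-⌜⌝ s | tailCode-⌜⌝ (reverse s) = reverseCode-⌜⌝ (drop 1 (reverse s))

  dropLastCode-[] : dropLastCode ⌜ [] ⌝ ≡ ⌜ [] ⌝
  dropLastCode-[] = dropLastCode-⌜⌝ []

  dropLastCode-∷ʳ : ∀ s a → dropLastCode ⌜ s ∷ʳ a ⌝ ≡ ⌜ s ⌝
  dropLastCode-∷ʳ s a = begin
    dropLastCode ⌜ s ∷ʳ a ⌝                  ≡⟨ dropLastCode-⌜⌝ (s ∷ʳ a) ⟩
    ⌜ reverse (drop 1 (reverse (s ∷ʳ a))) ⌝  ≡⟨ cong (λ t → ⌜ reverse (drop 1 t) ⌝) (reverse-++ s (a ∷ [])) ⟩
    ⌜ reverse (reverse s) ⌝                  ≡⟨ cong ⌜_⌝ (reverse-involutive s) ⟩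
    ⌜ s ⌝                                    ∎
    where open ≡-Reasoning

  private
    tailCodeᴾ : PR 1
    tailCodeᴾ = sndᴾ ∙ predᴾ

    tailCodeᴾ⇓ : Computes₁ tailCodeᴾ tailCode
    tailCodeᴾ⇓ n = sndᴾ⇓ ∙⇓ predᴾ⇓ n

    moveHeadᴾ : PR 2
    moveHeadᴾ = caseᴾ π₁ ⟪ π₀ , constᴾ 0 ⟫ᴾ ⟪ S ∙ ⟪ fstᴾ ∙ predᴾ ∙ π₁ , π₀ ⟫ᴾ , sndᴾ ∙ predᴾ ∙ π₁ ⟫ᴾ

    moveHeadᴾ⇓ : Computes₂ moveHeadᴾ moveHead
    moveHeadᴾ⇓ acc rest =
      caseᴾ⇓ ⇓P ⟪ ⇓P , constᴾ⇓ 0 ⟫⇓ ⟪ S⇓ ∙⇓ ⟪ fstᴾ⇓ ∙⇓ predᴾ⇓ ∙⇓ ⇓P , ⇓P ⟫⇓ , sndᴾ⇓ ∙⇓ predᴾ⇓ ∙⇓ ⇓P ⟫⇓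

    iterᴾ : PR 1 → PR 2
    iterᴾ f = prim π₀ (f ∙ π₁)

    iterᴾ⇓ : ∀ {f g} → Computes₁ f g → Computes₂ (iterᴾ f) (λ k x → fold x g k)
    iterᴾ⇓ f⇓ zero    x = ⇓prim0 ⇓P
    iterᴾ⇓ f⇓ (suc k) x = ⇓primS (iterᴾ⇓ f⇓ k x) (f⇓ ∙⇓ ⇓P)

  reverseCodeᴾ : PR 1
  reverseCodeᴾ = fstᴾ ∙ comp₂ (iterᴾ (comp₂ moveHeadᴾ fstᴾ sndᴾ)) π₀ ⟪ constᴾ 0 , π₀ ⟫ᴾ

  reverseCodeᴾ⇓ : Computes₁ reverseCodeᴾ reverseCode
  reverseCodeᴾ⇓ n = fstᴾ⇓ ∙⇓ comp₂⇓ ⇓P ⟪ constᴾ⇓ 0 , ⇓P ⟫⇓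
    (⇓-resp-≡ (iterate-is-fold ⟪ 0 , n ⟫ reverseStep n)
      (iterᴾ⇓ (λ st → comp₂⇓ (fstᴾ⇓ st) (sndᴾ⇓ st) (moveHeadᴾ⇓ _ _)) n ⟪ 0 , n ⟫))

  dropLastCodeᴾ : PR 1
  dropLastCodeᴾ = reverseCodeᴾ ∙ tailCodeᴾ ∙ reverseCodeᴾ

  dropLastCodeᴾ⇓ : Computes₁ dropLastCodeᴾ dropLastCode
  dropLastCodeᴾ⇓ n = reverseCodeᴾ⇓ ∙⇓ tailCodeᴾ⇓ ∙⇓ reverseCodeᴾ⇓ n

module Tilings where

  open Pairing
  open StringCodes using (decode; decode-⌜⌝; ⌜⌝-injective)
  open import Data.Nat as ℕ using (ℕ; zero; suc)
  import Data.Nat.Properties as ℕ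
  open import Data.Integer using (ℤ; +_; -[1+_]; 0ℤ; 1ℤ; _+_; _-_; -_)
  open import Data.Integer.Properties using (+-assoc; +-identityˡ; +-identityʳ; +-inverseʳ; +-0-abelianGroup)
  open import Data.Integer.Tactic.RingSolver using (solve-∀)
  open import Algebra.Bundles using (AbelianGroup)
  open import Algebra.Properties.Group (AbelianGroup.group +-0-abelianGroup) using (identityʳ-unique)
  open import Data.List using (List; []; _∷_; _∷ʳ_; length; applyUpTo)
  open import Data.List.Properties using (applyUpTo-∷ʳ; length-++)
  open import Data.Product using (Σ; _×_; _,_; proj₁; proj₂)
  open import Relation.Nullary using (¬_; contradiction)
  open import Data.Empty using (⊥-elim)
  open import Relation.Binary.PropositionalEquality
  open import Function using (_∘_)

  ℤ-constant : ∀ {A : Set} (h : ℤ → A) → (∀ z → h (z + 1ℤ) ≡ h z) → ∀ z → h z ≡ h 0ℤ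
  ℤ-constant h step (+ zero)     = refl
  ℤ-constant h step (+ suc n)    =
    trans (cong (h ∘ +_) (ℕ.+-comm 1 n)) (trans (step (+ n)) (ℤ-constant h step (+ n)))
  ℤ-constant h step -[1+ zero ]  = sym (step -[1+ 0 ])
  ℤ-constant h step -[1+ suc n ] = trans (sym (step -[1+ suc n ])) (ℤ-constant h step -[1+ n ])

  ℤ-translation : (g : ℤ → ℤ) → (∀ z → g (z + 1ℤ) ≡ g z + 1ℤ) → ∀ z → g z ≡ g 0ℤ + z
  ℤ-translation g step z = begin
    g z             ≡⟨ a≡a-z+z (g z) z ⟩
    g z - z + z     ≡⟨ cong (_+ z) (ℤ-constant (λ z → g z - z) difference-step z) ⟩
    g 0ℤ - 0ℤ + z   ≡⟨ cong (_+ z) (+-identityʳ (g 0ℤ)) ⟩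
    g 0ℤ + z        ∎
    where
    open ≡-Reasoning
    a≡a-z+z : ∀ a z → a ≡ a - z + z
    a≡a-z+z = solve-∀
    shift : ∀ a z → a + 1ℤ - (z + 1ℤ) ≡ a - z
    shift = solve-∀
    difference-step : ∀ z → g (z + 1ℤ) - (z + 1ℤ) ≡ g z - z
    difference-step z = trans (cong (_- (z + 1ℤ)) (step z)) (shift (g z) z)

  -- Horizontal colours ⟪ 0 , n ⟫ and ⟪ 1 , n ⟫ stand for the integers -1-n and n.  Vertical colours
  -- ⟪ 0 , n ⟫ stand for the row -1-n, and ⟪ 1 , ⌜ s ⌝ ⟫ for the string s, which sits on row length s.
  data HSucc : ℕ → ℕ → Set where
    negative : ∀ n → HSucc ⟪ 0 , suc n ⟫ ⟪ 0 , n ⟫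
    crossing : HSucc ⟪ 0 , 0 ⟫ ⟪ 1 , 0 ⟫
    positive : ∀ n → HSucc ⟪ 1 , n ⟫ ⟪ 1 , n ℕ.+ 1 ⟫

  data VSucc (Q : ℕ → Set) : ℕ → ℕ → Set where
    negative : ∀ n → VSucc Q ⟪ 0 , suc n ⟫ ⟪ 0 , n ⟫
    crossing : VSucc Q ⟪ 0 , 0 ⟫ ⟪ 1 , ⌜ [] ⌝ ⟫
    extend   : ∀ s a → Q ⌜ s ∷ʳ a ⌝ → VSucc Q ⟪ 1 , ⌜ s ⌝ ⟫ ⟪ 1 , ⌜ s ∷ʳ a ⌝ ⟫

  private
    hSigned vSigned : ℕ → ℕ → ℤ
    hSigned zero    n = -[1+ n ]
    hSigned (suc _) n = + n
    vSigned zero    n = -[1+ n ]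
    vSigned (suc _) w = + length (decode w)

  hIndex vIndex : ℕ → ℤ
  hIndex c = hSigned (fst c) (snd c)
  vIndex c = vSigned (fst c) (snd c)

  hIndex-⟪0,⟫ : ∀ n → hIndex ⟪ 0 , n ⟫ ≡ -[1+ n ]
  hIndex-⟪0,⟫ n = cong₂ hSigned (fst-⟪⟫ 0 n) (snd-⟪⟫ 0 n)

  hIndex-⟪1,⟫ : ∀ n → hIndex ⟪ 1 , n ⟫ ≡ + n
  hIndex-⟪1,⟫ n = cong₂ hSigned (fst-⟪⟫ 1 n) (snd-⟪⟫ 1 n)

  vIndex-⟪0,⟫ : ∀ n → vIndex ⟪ 0 , n ⟫ ≡ -[1+ n ]
  vIndex-⟪0,⟫ n = cong₂ vSigned (fst-⟪⟫ 0 n) (snd-⟪⟫ 0 n)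

  vIndex-⟪1,⟫ : ∀ s → vIndex ⟪ 1 , ⌜ s ⌝ ⟫ ≡ + length s
  vIndex-⟪1,⟫ s = trans (cong₂ vSigned (fst-⟪⟫ 1 ⌜ s ⌝) (snd-⟪⟫ 1 ⌜ s ⌝)) (cong (+_ ∘ length) (decode-⌜⌝ s))

  HSucc-hIndex : ∀ {a b} → HSucc a b → hIndex b ≡ hIndex a + 1ℤ
  HSucc-hIndex (negative n) rewrite hIndex-⟪0,⟫ n | hIndex-⟪0,⟫ (suc n) = refl
  HSucc-hIndex crossing     rewrite hIndex-⟪1,⟫ 0 | hIndex-⟪0,⟫ 0 = refl
  HSucc-hIndex (positive n) rewrite hIndex-⟪1,⟫ n | hIndex-⟪1,⟫ (n ℕ.+ 1) = refl

  VSucc-vIndex : ∀ {Q b u} → VSucc Q b u → vIndex u ≡ vIndex b + 1ℤ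
  VSucc-vIndex (negative n) rewrite vIndex-⟪0,⟫ n | vIndex-⟪0,⟫ (suc n) = refl
  VSucc-vIndex crossing     rewrite vIndex-⟪1,⟫ [] | vIndex-⟪0,⟫ 0 = refl
  VSucc-vIndex (extend s a _) rewrite vIndex-⟪1,⟫ (s ∷ʳ a) | vIndex-⟪1,⟫ s =
    cong +_ (length-++ s)

  vIndex≡0 : ∀ {Q b u} → VSucc Q b u → vIndex b ≡ 0ℤ → b ≡ ⟪ 1 , ⌜ [] ⌝ ⟫
  vIndex≡0 (negative n)         eq = contradiction (trans (sym (vIndex-⟪0,⟫ (suc n))) eq) λ ()
  vIndex≡0 crossing             eq = contradiction (trans (sym (vIndex-⟪0,⟫ 0)) eq) λ ()
  vIndex≡0 (extend [] a _)      _  = refl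
  vIndex≡0 (extend (x ∷ s) a _) eq = contradiction (trans (sym (vIndex-⟪1,⟫ (x ∷ s))) eq) λ ()

  VSucc-⟪1,⟫ : ∀ {Q b u} s → b ≡ ⟪ 1 , ⌜ s ⌝ ⟫ → VSucc Q b u →
               Σ ℕ λ a → u ≡ ⟪ 1 , ⌜ s ∷ʳ a ⌝ ⟫ × Q ⌜ s ∷ʳ a ⌝
  VSucc-⟪1,⟫ s eq (negative n) = ⊥-elim (⟪0,⟫≢⟪1,⟫ (suc n) ⌜ s ⌝ eq)
  VSucc-⟪1,⟫ s eq crossing     = ⊥-elim (⟪0,⟫≢⟪1,⟫ 0 ⌜ s ⌝ eq)
  VSucc-⟪1,⟫ s eq (extend t a q)
    with refl ← ⌜⌝-injective t s (proj₂ (⟪⟫-injective 1 ⌜ t ⌝ 1 ⌜ s ⌝ eq)) = a , refl , q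

  hColour : ℤ → ℕ
  hColour (+ n)    = ⟪ 1 , n ⟫
  hColour -[1+ n ] = ⟪ 0 , n ⟫

  hColour-HSucc : ∀ z → HSucc (hColour z) (hColour (z + 1ℤ))
  hColour-HSucc (+ n)        = positive n
  hColour-HSucc -[1+ zero ]  = crossing
  hColour-HSucc -[1+ suc n ] = negative n

  vColour : (ℕ → ℕ) → ℤ → ℕ
  vColour p (+ n)    = ⟪ 1 , ⌜ applyUpTo p n ⌝ ⟫
  vColour p -[1+ n ] = ⟪ 0 , n ⟫

  vColour-VSucc : ∀ {Q p} → (∀ n → Q ⌜ applyUpTo p (suc n) ⌝) →
                  ∀ z → VSucc Q (vColour p z) (vColour p (z + 1ℤ))
  vColour-VSucc {Q} {p} Q-path (+ n) =
    subst (λ s → VSucc Q ⟪ 1 , ⌜ applyUpTo p n ⌝ ⟫ ⟪ 1 , ⌜ s ⌝ ⟫) ∷ʳ≡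
      (extend (applyUpTo p n) (p n) (subst (Q ∘ ⌜_⌝) (sym (applyUpTo-∷ʳ p n)) (Q-path n)))
    where
    ∷ʳ≡ : applyUpTo p n ∷ʳ p n ≡ applyUpTo p (n ℕ.+ 1)
    ∷ʳ≡ = trans (applyUpTo-∷ʳ p n) (cong (applyUpTo p) (ℕ.+-comm 1 n))
  vColour-VSucc Q-path -[1+ zero ]  = crossing
  vColour-VSucc Q-path -[1+ suc n ] = negative n

  record ValidTile (Q : ℕ → Set) (t : Tile) : Set where
    field
      upper-left  : fst (upper t) ≡ left t
      bottom-left : fst (bottom t) ≡ left t
      hsucc       : HSucc (left t) (right t)
      vsucc       : VSucc Q (snd (bottom t)) (snd (upper t))

  record ValidTiling (Q : ℕ → Set) (τ : ℤ → ℤ → Tile) : Set where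
    field
      valid  : ∀ x y → ValidTile Q (τ x y)
      matchH : ∀ x y → right (τ x y) ≡ left (τ (x + 1ℤ) y)
      matchV : ∀ x y → upper (τ x y) ≡ bottom (τ x (y + 1ℤ))

  VSucc-path : ∀ {Q} (d : ℕ → ℕ) → d 0 ≡ ⟪ 1 , ⌜ [] ⌝ ⟫ → (∀ n → VSucc Q (d n) (d (suc n))) →
               Σ (ℕ → ℕ) λ p → ∀ n → Q ⌜ applyUpTo p (suc n) ⌝
  VSucc-path {Q} d d0 step = letter , Q-letters
    where
    mutual
      word : ∀ n → Σ (List ℕ) λ s → d n ≡ ⟪ 1 , ⌜ s ⌝ ⟫
      word zero    = [] , d0
      word (suc n) = proj₁ (word n) ∷ʳ proj₁ (growth n) , proj₁ (proj₂ (growth n))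

      growth : ∀ n → Σ ℕ λ a → d (suc n) ≡ ⟪ 1 , ⌜ proj₁ (word n) ∷ʳ a ⌝ ⟫ × Q ⌜ proj₁ (word n) ∷ʳ a ⌝
      growth n = VSucc-⟪1,⟫ (proj₁ (word n)) (proj₂ (word n)) (step n)

    letter : ℕ → ℕ
    letter n = proj₁ (growth n)

    word≡ : ∀ n → proj₁ (word n) ≡ applyUpTo letter n
    word≡ zero    = refl
    word≡ (suc n) = trans (cong (_∷ʳ letter n) (word≡ n)) (applyUpTo-∷ʳ letter n)

    Q-letters : ∀ n → Q ⌜ applyUpTo letter (suc n) ⌝
    Q-letters n = subst (Q ∘ ⌜_⌝) (word≡ (suc n)) (proj₂ (proj₂ (growth n)))

  module _ {Q : ℕ → Set} {τ : ℤ → ℤ → Tile} (T : ValidTiling Q τ) where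

    open ValidTiling T
    open ValidTile

    private
      column : ℤ → ℤ → ℕ
      column x y = snd (bottom (τ x y))

      column-VSucc : ∀ x y → VSucc Q (column x y) (column x (y + 1ℤ))
      column-VSucc x y = subst (VSucc Q (column x y)) (cong snd (matchV x y)) (vsucc (valid x y))

      leftIndex : ℤ → ℤ → ℤ
      leftIndex x y = hIndex (left (τ x y))

      leftIndex≡ : ∀ x y → leftIndex x y ≡ leftIndex 0ℤ 0ℤ + x
      leftIndex≡ x y = trans (ℤ-constant (leftIndex x) left-up y) (ℤ-translation (λ x → leftIndex x 0ℤ) left-right x)
        where
        left-up : ∀ y → leftIndex x (y + 1ℤ) ≡ leftIndex x y
        left-up y = cong hIndex (trans (sym (bottom-left (valid x (y + 1ℤ))))
                    (trans (cong fst (sym (matchV x y))) (upper-left (valid x y))))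
        left-right : ∀ x → leftIndex (x + 1ℤ) 0ℤ ≡ leftIndex x 0ℤ + 1ℤ
        left-right x = trans (cong hIndex (sym (matchH x 0ℤ))) (HSucc-hIndex (hsucc (valid x 0ℤ)))

      vpos≡ : ∀ x y → vIndex (column x y) ≡ vIndex (column x 0ℤ) + y
      vpos≡ x = ℤ-translation (vIndex ∘ column x) (λ y → VSucc-vIndex (column-VSucc x y))

    aperiodic : ¬ Periodic τ
    aperiodic (v₁ , v₂ , nonzero , periodic) = nonzero (v₁≡0 , v₂≡0)
      where
      τv≡τ0 : τ v₁ v₂ ≡ τ 0ℤ 0ℤ
      τv≡τ0 = subst₂ (λ x y → τ x y ≡ τ 0ℤ 0ℤ) (+-identityˡ v₁) (+-identityˡ v₂) (periodic 0ℤ 0ℤ)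
      v₁≡0 : v₁ ≡ 0ℤ
      v₁≡0 = identityʳ-unique (leftIndex 0ℤ 0ℤ) v₁ (trans (sym (leftIndex≡ v₁ v₂)) (cong (hIndex ∘ left) τv≡τ0))
      v₂≡0 : v₂ ≡ 0ℤ
      v₂≡0 = identityʳ-unique (vIndex (column 0ℤ 0ℤ)) v₂ (trans (sym (vpos≡ 0ℤ v₂))
               (cong (vIndex ∘ snd ∘ bottom) (subst (λ x → τ x v₂ ≡ τ 0ℤ 0ℤ) v₁≡0 τv≡τ0)))

    column-path : Σ (ℕ → ℕ) λ p → ∀ n → Q ⌜ applyUpTo p (suc n) ⌝
    column-path = VSucc-path (λ n → column 0ℤ (y₀ + + n)) origin step
      where
      y₀ : ℤ
      y₀ = - vIndex (column 0ℤ 0ℤ)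
      origin : column 0ℤ (y₀ + + 0) ≡ ⟪ 1 , ⌜ [] ⌝ ⟫
      origin = vIndex≡0 (column-VSucc 0ℤ (y₀ + + 0)) (begin
        vIndex (column 0ℤ (y₀ + + 0))        ≡⟨ vpos≡ 0ℤ (y₀ + + 0) ⟩
        vIndex (column 0ℤ 0ℤ) + (y₀ + + 0)   ≡⟨ cong (λ y → vIndex (column 0ℤ 0ℤ) + y) (+-identityʳ y₀) ⟩
        vIndex (column 0ℤ 0ℤ) + y₀           ≡⟨ +-inverseʳ (vIndex (column 0ℤ 0ℤ)) ⟩
        0ℤ                                   ∎)
        where open ≡-Reasoning
      step : ∀ n → VSucc Q (column 0ℤ (y₀ + + n)) (column 0ℤ (y₀ + + suc n))
      step n = subst (λ y → VSucc Q (column 0ℤ (y₀ + + n)) (column 0ℤ y))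
        (trans (+-assoc y₀ (+ n) 1ℤ) (cong (λ n → y₀ + + n) (ℕ.+-comm n 1))) (column-VSucc 0ℤ (y₀ + + n))

  pathTiling : (ℕ → ℕ) → ℤ → ℤ → Tile
  pathTiling p x y =
    ⟨ hColour x , ⟪ hColour x , vColour p (y + 1ℤ) ⟫ , hColour (x + 1ℤ) , ⟪ hColour x , vColour p y ⟫ ⟩

  pathTiling-valid : ∀ {Q p} → (∀ n → Q ⌜ applyUpTo p (suc n) ⌝) → ValidTiling Q (pathTiling p)
  pathTiling-valid {Q} {p} Q-path = record
    { valid  = λ x y → record
      { upper-left  = fst-⟪⟫ (hColour x) (vColour p (y + 1ℤ))
      ; bottom-left = fst-⟪⟫ (hColour x) (vColour p y)
      ; hsucc       = hColour-HSucc x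
      ; vsucc       = subst₂ (VSucc Q) (sym (snd-⟪⟫ (hColour x) (vColour p y)))
                        (sym (snd-⟪⟫ (hColour x) (vColour p (y + 1ℤ)))) (vColour-VSucc Q-path y)
      }
    ; matchH = λ _ _ → refl
    ; matchV = λ _ _ → refl
    }

module TileCheck where

  open Pairing
  open Programs
  open StringCodes
  open Tilings
  open import Data.Nat
  open import Data.Nat.Properties
  open import Data.List using (List; _∷ʳ_)
  open import Data.Vec using (Vec)
  open import Data.Product using (Σ; _×_; _,_)
  open import Data.Sum using (_⊎_; inj₁; inj₂)
  open import Data.Empty using (⊥-elim)
  open import Relation.Binary.PropositionalEquality
  open import Relation.Nullary using (contradiction)

  -- A condition is checked by a number that vanishes exactly when the condition holds;
  -- + then expresses conjunction and * disjunction.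
  private
    +≡0 : ∀ {m n} → m + n ≡ 0 → m ≡ 0 × n ≡ 0
    +≡0 {m} eq = m+n≡0⇒m≡0 m eq , m+n≡0⇒n≡0 m eq

    *≡0 : ∀ {m n} → m * n ≡ 0 → m ≡ 0 ⊎ n ≡ 0
    *≡0 {m} = m*n≡0⇒m≡0∨n≡0 m

    *≡0ˡ : ∀ {m} n → m ≡ 0 → m * n ≡ 0
    *≡0ˡ n refl = refl

    *≡0ʳ : ∀ m {n} → n ≡ 0 → m * n ≡ 0
    *≡0ʳ m refl = *-zeroʳ m

  negativeStep crossingStep positiveStep extendStep : ℕ → ℕ → ℕ
  negativeStep a b = fst a + fst b + ∣ snd a - suc (snd b) ∣
  crossingStep a b = a + ∣ b - 1 ∣
  positiveStep a b = ∣ fst a - 1 ∣ + ∣ fst b - 1 ∣ + ∣ snd b - (snd a + 1) ∣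
  extendStep   b u = ∣ fst b - 1 ∣ + ∣ fst u - 1 ∣ + (1 ∸ snd u) + ∣ dropLastCode (snd u) - snd b ∣

  hsuccDefect : ℕ → ℕ → ℕ
  hsuccDefect a b = negativeStep a b * crossingStep a b * positiveStep a b

  vsuccDefect : ℕ → ℕ → ℕ → ℕ
  vsuccDefect y b u = negativeStep b u * crossingStep b u * (extendStep b u + ∣ y - 1 ∣)

  private
    negativeStep-sound : ∀ {a b} → negativeStep a b ≡ 0 → a ≡ ⟪ 0 , suc (snd b) ⟫ × b ≡ ⟪ 0 , snd b ⟫
    negativeStep-sound eq with eq′ , snd≡ ← +≡0 eq with fst-a≡0 , fst-b≡0 ← +≡0 eq′ =
      fst-snd⇒≡⟪⟫ fst-a≡0 (∣m-n∣≡0⇒m≡n snd≡) , fst-snd⇒≡⟪⟫ fst-b≡0 refl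

    crossingStep-sound : ∀ {a b} → crossingStep a b ≡ 0 → a ≡ 0 × b ≡ 1
    crossingStep-sound eq with a≡0 , eq′ ← +≡0 eq = a≡0 , ∣m-n∣≡0⇒m≡n eq′

    positiveStep-sound : ∀ {a b} → positiveStep a b ≡ 0 → a ≡ ⟪ 1 , snd a ⟫ × b ≡ ⟪ 1 , snd a + 1 ⟫
    positiveStep-sound eq with eq′ , snd≡ ← +≡0 eq with fst-a≡1 , fst-b≡1 ← +≡0 eq′ =
      fst-snd⇒≡⟪⟫ (∣m-n∣≡0⇒m≡n fst-a≡1) refl , fst-snd⇒≡⟪⟫ (∣m-n∣≡0⇒m≡n fst-b≡1) (∣m-n∣≡0⇒m≡n snd≡)

    extendStep-sound : ∀ {b u} → extendStep b u ≡ 0 →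
                       Σ (List ℕ) λ s → Σ ℕ λ a → b ≡ ⟪ 1 , ⌜ s ⌝ ⟫ × u ≡ ⟪ 1 , ⌜ s ∷ʳ a ⌝ ⟫
    extendStep-sound {b} {u} eq
      with eq₁ , dl≡ ← +≡0 eq with eq₂ , nonempty ← +≡0 eq₁ with fst-b≡1 , fst-u≡1 ← +≡0 eq₂
      with ⌜⌝-initLast (snd u)
    ... | inj₁ empty with () ← subst (λ w → 1 ∸ w ≡ 0) empty nonempty
    ... | inj₂ (s , a , snd-u≡) =
      s , a ,
      fst-snd⇒≡⟪⟫ (∣m-n∣≡0⇒m≡n fst-b≡1)
        (trans (sym (∣m-n∣≡0⇒m≡n dl≡)) (trans (cong dropLastCode snd-u≡) (dropLastCode-∷ʳ s a))) ,
      fst-snd⇒≡⟪⟫ (∣m-n∣≡0⇒m≡n fst-u≡1) snd-u≡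

    reshape : ∀ {R : ℕ → ℕ → Set} {a b a′ b′} → a ≡ a′ × b ≡ b′ → R a′ b′ → R a b
    reshape {R} (refl , refl) r = r

  hsuccDefect-sound : ∀ {a b} → hsuccDefect a b ≡ 0 → HSucc a b
  hsuccDefect-sound {a} {b} eq with *≡0 {negativeStep a b * crossingStep a b} eq
  ... | inj₂ pos = reshape {HSucc} (positiveStep-sound pos) (positive (snd a))
  ... | inj₁ eq′ with *≡0 {negativeStep a b} eq′
  ...   | inj₁ neg   = reshape {HSucc} (negativeStep-sound neg) (negative (snd b))
  ...   | inj₂ cross = reshape {HSucc} (crossingStep-sound cross) crossing

  vsuccDefect-sound : ∀ {Q y b u} → vsuccDefect y b u ≡ 0 → (y ≡ 1 → Q (snd u)) → VSucc Q b u
  vsuccDefect-sound {Q} {y} {b} {u} eq Q-upper with *≡0 {negativeStep b u * crossingStep b u} eq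
  ... | inj₁ eq′ with *≡0 {negativeStep b u} eq′
  ...   | inj₁ neg   = reshape {VSucc Q} (negativeStep-sound neg) (negative (snd u))
  ...   | inj₂ cross = reshape {VSucc Q} (crossingStep-sound cross) crossing
  vsuccDefect-sound {Q} {y} {b} {u} eq Q-upper | inj₂ ext
    with ext′ , y≡ ← +≡0 ext
    with s , a , b≡ , u≡ ← extendStep-sound ext′ =
    reshape {VSucc Q} (b≡ , u≡) (extend s a (subst Q (trans (cong snd u≡) (snd-⟪⟫ 1 ⌜ s ∷ʳ a ⌝)) (Q-upper (∣m-n∣≡0⇒m≡n y≡))))

  private
    components : ∀ (f : ℕ → ℕ → ℕ → ℕ → ℕ) a b c d →
                 f (fst ⟪ a , b ⟫) (snd ⟪ a , b ⟫) (fst ⟪ c , d ⟫) (snd ⟪ c , d ⟫) ≡ f a b c d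
    components f a b c d = trans (cong₂ (λ x y → f x y _ _) (fst-⟪⟫ a b) (snd-⟪⟫ a b))
                                 (cong₂ (f a b) (fst-⟪⟫ c d) (snd-⟪⟫ c d))

    negativeStep-complete : ∀ n → negativeStep ⟪ 0 , suc n ⟫ ⟪ 0 , n ⟫ ≡ 0
    negativeStep-complete n =
      trans (components (λ t m t′ m′ → t + t′ + ∣ m - suc m′ ∣) 0 (suc n) 0 n) (∣n-n∣≡0 n)

    positiveStep-complete : ∀ n → positiveStep ⟪ 1 , n ⟫ ⟪ 1 , n + 1 ⟫ ≡ 0
    positiveStep-complete n =
      trans (components (λ t m t′ m′ → ∣ t - 1 ∣ + ∣ t′ - 1 ∣ + ∣ m′ - (m + 1) ∣) 1 n 1 (n + 1)) (∣n-n∣≡0 (n + 1))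

    extendStep-complete : ∀ s a → extendStep ⟪ 1 , ⌜ s ⌝ ⟫ ⟪ 1 , ⌜ s ∷ʳ a ⌝ ⟫ ≡ 0
    extendStep-complete s a =
      trans (components (λ t v t′ w → ∣ t - 1 ∣ + ∣ t′ - 1 ∣ + (1 ∸ w) + ∣ dropLastCode w - v ∣) 1 ⌜ s ⌝ 1 ⌜ s ∷ʳ a ⌝)
            (cong₂ _+_ (m≤n⇒m∸n≡0 (⌜∷ʳ⌝>0 s a))
                       (trans (cong (λ w → ∣ w - ⌜ s ⌝ ∣) (dropLastCode-∷ʳ s a)) (∣n-n∣≡0 ⌜ s ⌝)))

  hsuccDefect-complete : ∀ {a b} → HSucc a b → hsuccDefect a b ≡ 0
  hsuccDefect-complete (negative n) = *≡0ˡ _ (*≡0ˡ _ (negativeStep-complete n))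
  hsuccDefect-complete crossing     = *≡0ˡ _ (*≡0ʳ (negativeStep 0 1) refl)
  hsuccDefect-complete (positive n) =
    *≡0ʳ (negativeStep ⟪ 1 , n ⟫ ⟪ 1 , n + 1 ⟫ * crossingStep ⟪ 1 , n ⟫ ⟪ 1 , n + 1 ⟫) (positiveStep-complete n)

  vsuccDefect-complete : ∀ {Q y b u} → VSucc Q b u → (Q (snd u) → y ≡ 1) → vsuccDefect y b u ≡ 0
  vsuccDefect-complete (negative n)     _  = *≡0ˡ _ (*≡0ˡ _ (negativeStep-complete n))
  vsuccDefect-complete crossing         _  = *≡0ˡ _ (*≡0ʳ (negativeStep 0 1) refl)
  vsuccDefect-complete {Q} (extend s a q) y≡1 =
    *≡0ʳ (negativeStep b u * crossingStep b u)
         (cong₂ _+_ (extendStep-complete s a) (m≡n⇒∣m-n∣≡0 (y≡1 (subst Q (sym (snd-⟪⟫ 1 ⌜ s ∷ʳ a ⌝)) q))))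
    where
    b u : ℕ
    b = ⟪ 1 , ⌜ s ⌝ ⟫
    u = ⟪ 1 , ⌜ s ∷ʳ a ⌝ ⟫

  tileDefect : ℕ → Tile → ℕ
  tileDefect y t = ∣ fst (upper t) - left t ∣ + ∣ fst (bottom t) - left t ∣ + hsuccDefect (left t) (right t)
                 + vsuccDefect y (snd (bottom t)) (snd (upper t))

  upperWord : Tile → ℕ
  upperWord t = snd (snd (upper t))

  tileDefect-sound : ∀ {Q y t} → tileDefect y t ≡ 0 → (y ≡ 1 → Q (upperWord t)) → ValidTile Q t
  tileDefect-sound eq Q-upper with eq₁ , v≡0 ← +≡0 eq with eq₂ , h≡0 ← +≡0 eq₁ with u≡0 , b≡0 ← +≡0 eq₂ = record
    { upper-left  = ∣m-n∣≡0⇒m≡n u≡0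
    ; bottom-left = ∣m-n∣≡0⇒m≡n b≡0
    ; hsucc       = hsuccDefect-sound h≡0
    ; vsucc       = vsuccDefect-sound v≡0 Q-upper
    }

  tileDefect-complete : ∀ {Q y t} → ValidTile Q t → (Q (upperWord t) → y ≡ 1) → tileDefect y t ≡ 0
  tileDefect-complete valid y≡1 =
    cong₂ _+_ (cong₂ _+_ (cong₂ _+_ (m≡n⇒∣m-n∣≡0 upper-left) (m≡n⇒∣m-n∣≡0 bottom-left))
                         (hsuccDefect-complete hsucc))
              (vsuccDefect-complete vsucc y≡1)
    where open ValidTile valid

  decodeTile : ℕ → Tile
  decodeTile x = ⟨ fst x , fst (snd x) , fst (snd (snd x)) , snd (snd (snd x)) ⟩

  decodeTile-⌜⌝ᵗ : ∀ t → decodeTile ⌜ t ⌝ᵗ ≡ t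
  decodeTile-⌜⌝ᵗ ⟨ l , u , r , b ⟩ =
    trans (cong₂ (λ l′ w → ⟨ l′ , fst w , fst (snd w) , snd (snd w) ⟩) (fst-⟪⟫ l ⟪ u , ⟪ r , b ⟫ ⟫) (snd-⟪⟫ l ⟪ u , ⟪ r , b ⟫ ⟫))
    (trans (cong₂ (λ u′ w → ⟨ l , u′ , fst w , snd w ⟩) (fst-⟪⟫ u ⟪ r , b ⟫) (snd-⟪⟫ u ⟪ r , b ⟫))
           (cong₂ (λ r′ b′ → ⟨ l , u , r′ , b′ ⟩) (fst-⟪⟫ r b) (snd-⟪⟫ r b)))

  Bit : ℕ → Set
  Bit v = v ≡ 0 ⊎ v ≡ 1

  sanityDefect : ℕ → ℕ → ℕ
  sanityDefect y₁ y₂ = y₁ * (∣ y₁ - 1 ∣ + ∣ y₂ - 1 ∣)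

  sanityDefect-sound : ∀ y₁ y₂ → sanityDefect y₁ y₂ ≡ 0 → y₁ ≡ 0 ⊎ y₁ ≡ 1 × y₂ ≡ 1
  sanityDefect-sound y₁ y₂ eq with *≡0 {y₁} eq
  ... | inj₁ y₁≡0 = inj₁ y₁≡0
  ... | inj₂ eq′  with y₁≡1 , y₂≡1 ← +≡0 eq′ = inj₂ (∣m-n∣≡0⇒m≡n y₁≡1 , ∣m-n∣≡0⇒m≡n y₂≡1)

  sanityDefect-complete : ∀ y₁ y₂ → y₁ ≡ 0 ⊎ y₁ ≡ 1 × y₂ ≡ 1 → sanityDefect y₁ y₂ ≡ 0
  sanityDefect-complete _ _ (inj₁ refl)          = refl
  sanityDefect-complete _ _ (inj₂ (refl , refl)) = refl

  -- y₁, y₂ and y₃ are the answers of φ_e at x, at x with its last letter dropped, and at the word in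
  -- the upper colour of the tile x.  The output is a bit only if y₁ and y₂ are consistent with φ_e
  -- being the characteristic function of a tree, and it is then 1 exactly on the valid tiles.
  tileOutput : ℕ → ℕ → ℕ → ℕ → ℕ
  tileOutput y₁ y₂ y₃ x = 1 ∸ tileDefect y₃ (decodeTile x) + 2 * sanityDefect y₁ y₂

  private
    output≡1 : ∀ d s → 1 ∸ d + 2 * s ≡ 1 → d ≡ 0
    output≡1 zero    s _  = refl
    output≡1 (suc d) s eq = ⊥-elim (even≢odd s 0 (trans (cong (_+ 2 * s) (sym (0∸n≡0 d))) eq))

    Bit⇒≤1 : ∀ {v} → Bit v → v ≤ 1
    Bit⇒≤1 (inj₁ refl) = z≤n
    Bit⇒≤1 (inj₂ refl) = ≤-refl

    output-Bit : ∀ d s → Bit (1 ∸ d + 2 * s) → s ≡ 0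
    output-Bit d zero    _      = refl
    output-Bit d (suc s) output =
      contradiction (≤-trans (*-monoʳ-≤ 2 (s≤s z≤n)) (m≤n+m (2 * suc s) (1 ∸ d))) (≤⇒≯ (Bit⇒≤1 output))

  tileOutput≡1⇒ : ∀ y₁ y₂ y₃ x → tileOutput y₁ y₂ y₃ x ≡ 1 → tileDefect y₃ (decodeTile x) ≡ 0
  tileOutput≡1⇒ y₁ y₂ y₃ x = output≡1 (tileDefect y₃ (decodeTile x)) (sanityDefect y₁ y₂)

  tileOutput-Bit⇒ : ∀ y₁ y₂ y₃ x → Bit (tileOutput y₁ y₂ y₃ x) → sanityDefect y₁ y₂ ≡ 0
  tileOutput-Bit⇒ y₁ y₂ y₃ x = output-Bit (tileDefect y₃ (decodeTile x)) (sanityDefect y₁ y₂)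

  tileOutput-Bit : ∀ y₁ y₂ y₃ x → sanityDefect y₁ y₂ ≡ 0 → Bit (tileOutput y₁ y₂ y₃ x)
  tileOutput-Bit y₁ y₂ y₃ x eq =
    subst (λ s → Bit (1 ∸ tileDefect y₃ (decodeTile x) + 2 * s)) (sym eq) (sane (tileDefect y₃ (decodeTile x)))
    where
    sane : ∀ d → Bit (1 ∸ d + 2 * 0)
    sane zero    = inj₂ refl
    sane (suc d) = inj₁ (trans (+-identityʳ (0 ∸ d)) (0∸n≡0 d))

  tileOutput≡1 : ∀ y₁ y₂ y₃ x → sanityDefect y₁ y₂ ≡ 0 → tileDefect y₃ (decodeTile x) ≡ 0 →
                 tileOutput y₁ y₂ y₃ x ≡ 1
  tileOutput≡1 y₁ y₂ y₃ x s≡0 d≡0 rewrite s≡0 | d≡0 = refl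

  module _ {n : ℕ} where

    negativeStepᴾ crossingStepᴾ positiveStepᴾ extendStepᴾ hsuccDefectᴾ sanityDefectᴾ : PR n → PR n → PR n
    negativeStepᴾ a b = fstᴾ ∙ a +ᴾ fstᴾ ∙ b +ᴾ ∣ sndᴾ ∙ a -ᴾ S ∙ sndᴾ ∙ b ∣
    crossingStepᴾ a b = a +ᴾ ∣ b -ᴾ constᴾ 1 ∣
    positiveStepᴾ a b = ∣ fstᴾ ∙ a -ᴾ constᴾ 1 ∣ +ᴾ ∣ fstᴾ ∙ b -ᴾ constᴾ 1 ∣ +ᴾ ∣ sndᴾ ∙ b -ᴾ sndᴾ ∙ a +ᴾ constᴾ 1 ∣
    extendStepᴾ   b u = ∣ fstᴾ ∙ b -ᴾ constᴾ 1 ∣ +ᴾ ∣ fstᴾ ∙ u -ᴾ constᴾ 1 ∣ +ᴾ (constᴾ 1 ∸ᴾ sndᴾ ∙ u)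
                        +ᴾ ∣ dropLastCodeᴾ ∙ sndᴾ ∙ u -ᴾ sndᴾ ∙ b ∣
    hsuccDefectᴾ  a b = negativeStepᴾ a b *ᴾ crossingStepᴾ a b *ᴾ positiveStepᴾ a b
    sanityDefectᴾ a b = a *ᴾ (∣ a -ᴾ constᴾ 1 ∣ +ᴾ ∣ b -ᴾ constᴾ 1 ∣)

    vsuccDefectᴾ : PR n → PR n → PR n → PR n
    vsuccDefectᴾ y b u = negativeStepᴾ b u *ᴾ crossingStepᴾ b u *ᴾ (extendStepᴾ b u +ᴾ ∣ y -ᴾ constᴾ 1 ∣)

    leftᴾ upperᴾ rightᴾ bottomᴾ : PR n → PR n
    leftᴾ   x = fstᴾ ∙ x
    upperᴾ  x = fstᴾ ∙ sndᴾ ∙ x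
    rightᴾ  x = fstᴾ ∙ sndᴾ ∙ sndᴾ ∙ x
    bottomᴾ x = sndᴾ ∙ sndᴾ ∙ sndᴾ ∙ x

    tileDefectᴾ : PR n → PR n → PR n
    tileDefectᴾ y x = ∣ fstᴾ ∙ upperᴾ x -ᴾ leftᴾ x ∣ +ᴾ ∣ fstᴾ ∙ bottomᴾ x -ᴾ leftᴾ x ∣
                    +ᴾ hsuccDefectᴾ (leftᴾ x) (rightᴾ x) +ᴾ vsuccDefectᴾ y (sndᴾ ∙ bottomᴾ x) (sndᴾ ∙ upperᴾ x)

  private variable
    n a b c : ℕ
    xs : Vec ℕ n
    f g h : PR n

  negativeStepᴾ⇓ : f [ xs ]⇓ a → g [ xs ]⇓ b → negativeStepᴾ f g [ xs ]⇓ negativeStep a b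
  negativeStepᴾ⇓ f⇓ g⇓ = fstᴾ⇓ ∙⇓ f⇓ +⇓ fstᴾ⇓ ∙⇓ g⇓ +⇓ ∣ sndᴾ⇓ ∙⇓ f⇓ -⇓ S⇓ ∙⇓ sndᴾ⇓ ∙⇓ g⇓ ∣

  crossingStepᴾ⇓ : f [ xs ]⇓ a → g [ xs ]⇓ b → crossingStepᴾ f g [ xs ]⇓ crossingStep a b
  crossingStepᴾ⇓ f⇓ g⇓ = f⇓ +⇓ ∣ g⇓ -⇓ constᴾ⇓ 1 ∣

  positiveStepᴾ⇓ : f [ xs ]⇓ a → g [ xs ]⇓ b → positiveStepᴾ f g [ xs ]⇓ positiveStep a b
  positiveStepᴾ⇓ f⇓ g⇓ = ∣ fstᴾ⇓ ∙⇓ f⇓ -⇓ constᴾ⇓ 1 ∣ +⇓ ∣ fstᴾ⇓ ∙⇓ g⇓ -⇓ constᴾ⇓ 1 ∣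
                         +⇓ ∣ sndᴾ⇓ ∙⇓ g⇓ -⇓ sndᴾ⇓ ∙⇓ f⇓ +⇓ constᴾ⇓ 1 ∣

  extendStepᴾ⇓ : f [ xs ]⇓ a → g [ xs ]⇓ b → extendStepᴾ f g [ xs ]⇓ extendStep a b
  extendStepᴾ⇓ f⇓ g⇓ = ∣ fstᴾ⇓ ∙⇓ f⇓ -⇓ constᴾ⇓ 1 ∣ +⇓ ∣ fstᴾ⇓ ∙⇓ g⇓ -⇓ constᴾ⇓ 1 ∣ +⇓ (constᴾ⇓ 1 ∸⇓ sndᴾ⇓ ∙⇓ g⇓)
                       +⇓ ∣ dropLastCodeᴾ⇓ ∙⇓ sndᴾ⇓ ∙⇓ g⇓ -⇓ sndᴾ⇓ ∙⇓ f⇓ ∣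

  hsuccDefectᴾ⇓ : f [ xs ]⇓ a → g [ xs ]⇓ b → hsuccDefectᴾ f g [ xs ]⇓ hsuccDefect a b
  hsuccDefectᴾ⇓ f⇓ g⇓ = negativeStepᴾ⇓ f⇓ g⇓ *⇓ crossingStepᴾ⇓ f⇓ g⇓ *⇓ positiveStepᴾ⇓ f⇓ g⇓

  vsuccDefectᴾ⇓ : f [ xs ]⇓ a → g [ xs ]⇓ b → h [ xs ]⇓ c → vsuccDefectᴾ f g h [ xs ]⇓ vsuccDefect a b c
  vsuccDefectᴾ⇓ f⇓ g⇓ h⇓ =
    negativeStepᴾ⇓ g⇓ h⇓ *⇓ crossingStepᴾ⇓ g⇓ h⇓ *⇓ (extendStepᴾ⇓ g⇓ h⇓ +⇓ ∣ f⇓ -⇓ constᴾ⇓ 1 ∣)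

  sanityDefectᴾ⇓ : f [ xs ]⇓ a → g [ xs ]⇓ b → sanityDefectᴾ f g [ xs ]⇓ sanityDefect a b
  sanityDefectᴾ⇓ f⇓ g⇓ = f⇓ *⇓ (∣ f⇓ -⇓ constᴾ⇓ 1 ∣ +⇓ ∣ g⇓ -⇓ constᴾ⇓ 1 ∣)

  leftᴾ⇓ : f [ xs ]⇓ a → leftᴾ f [ xs ]⇓ left (decodeTile a)
  leftᴾ⇓ f⇓ = fstᴾ⇓ ∙⇓ f⇓

  upperᴾ⇓ : f [ xs ]⇓ a → upperᴾ f [ xs ]⇓ upper (decodeTile a)
  upperᴾ⇓ f⇓ = fstᴾ⇓ ∙⇓ sndᴾ⇓ ∙⇓ f⇓

  rightᴾ⇓ : f [ xs ]⇓ a → rightᴾ f [ xs ]⇓ right (decodeTile a)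
  rightᴾ⇓ f⇓ = fstᴾ⇓ ∙⇓ sndᴾ⇓ ∙⇓ sndᴾ⇓ ∙⇓ f⇓

  bottomᴾ⇓ : f [ xs ]⇓ a → bottomᴾ f [ xs ]⇓ bottom (decodeTile a)
  bottomᴾ⇓ f⇓ = sndᴾ⇓ ∙⇓ sndᴾ⇓ ∙⇓ sndᴾ⇓ ∙⇓ f⇓

  tileDefectᴾ⇓ : f [ xs ]⇓ a → g [ xs ]⇓ b → tileDefectᴾ f g [ xs ]⇓ tileDefect a (decodeTile b)
  tileDefectᴾ⇓ f⇓ g⇓ = ∣ fstᴾ⇓ ∙⇓ upperᴾ⇓ g⇓ -⇓ leftᴾ⇓ g⇓ ∣ +⇓ ∣ fstᴾ⇓ ∙⇓ bottomᴾ⇓ g⇓ -⇓ leftᴾ⇓ g⇓ ∣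
                       +⇓ hsuccDefectᴾ⇓ (leftᴾ⇓ g⇓) (rightᴾ⇓ g⇓)
                       +⇓ vsuccDefectᴾ⇓ f⇓ (sndᴾ⇓ ∙⇓ bottomᴾ⇓ g⇓) (sndᴾ⇓ ∙⇓ upperᴾ⇓ g⇓)

module Reduction where

  open Pairing
  open Programs
  open StringCodes
  open Tilings
  open TileCheck
  open import Data.Nat
  open import Data.List using ([]; _∷_; _∷ʳ_)
  open import Data.List.Relation.Binary.Prefix.Heterogeneous using (_++ᵖ_)
  open import Data.List.Relation.Binary.Prefix.Heterogeneous.Properties using (fromPointwise)
  open import Data.List.Relation.Binary.Pointwise using (≡⇒Pointwise-≡)
  open import Data.Vec using (Vec; []; _∷_)
  open import Data.Product using (Σ; _×_; _,_; proj₁; proj₂)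
  open import Data.Sum using (_⊎_; inj₁; inj₂)
  open import Function using (_∘_; Equivalence)
  open import Relation.Binary.PropositionalEquality

  -- The programs of the reduction and their codes are opaque: unfolded, the codes are
  -- astronomically large numbers, on which the type checker would attempt to compute.
  opaque
    tileOutputᴾ : PR 4
    tileOutputᴾ = constᴾ 1 ∸ᴾ tileDefectᴾ π₂ π₃ +ᴾ constᴾ 2 *ᴾ sanityDefectᴾ π₀ π₁

    tileOutputᴾ⇓ : ∀ y₁ y₂ y₃ x → tileOutputᴾ [ y₁ ∷ y₂ ∷ y₃ ∷ x ∷ [] ]⇓ tileOutput y₁ y₂ y₃ x
    tileOutputᴾ⇓ _ _ _ _ = constᴾ⇓ 1 ∸⇓ tileDefectᴾ⇓ ⇓P ⇓P +⇓ constᴾ⇓ 2 *⇓ sanityDefectᴾ⇓ ⇓P ⇓P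

    dropLastᴾ : PR 1
    dropLastᴾ = dropLastCodeᴾ

    dropLastᴾ⇓ : Computes₁ dropLastᴾ dropLastCode
    dropLastᴾ⇓ = dropLastCodeᴾ⇓

    upperWordᴾ : PR 1
    upperWordᴾ = sndᴾ ∙ sndᴾ ∙ upperᴾ π₀

    upperWordᴾ⇓ : Computes₁ upperWordᴾ (upperWord ∘ decodeTile)
    upperWordᴾ⇓ _ = sndᴾ⇓ ∙⇓ sndᴾ⇓ ∙⇓ upperᴾ⇓ ⇓P

  record Trace (c : PR 1) (x v : ℕ) : Set where
    field
      {answer₁ answer₂ answer₃} : ℕ
      query₁ : c [ x ∷ [] ]⇓ answer₁
      query₂ : c [ dropLastCode x ∷ [] ]⇓ answer₂
      query₃ : c [ upperWord (decodeTile x) ∷ [] ]⇓ answer₃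
      output : v ≡ tileOutput answer₁ answer₂ answer₃ x

  opaque
    Tᴾ : PR 1 → PR 1
    Tᴾ c = comp tileOutputᴾ (c ∷ c ∙ dropLastᴾ ∷ c ∙ upperWordᴾ ∷ π₀ ∷ [])

    queriesCode : ℕ → ℕ
    queriesCode e = consCode (compCode 1 e (consCode (encode dropLastᴾ) 0))
                   (consCode (compCode 1 e (consCode (encode upperWordᴾ) 0))
                   (consCode (encode (π₀ {0})) 0))

    reduction : ℕ → ℕ
    reduction e = compCode 4 (encode tileOutputᴾ) (consCode e (queriesCode e))

    -- In two steps: a single refl makes the type checker unfold both sides into arithmetic and blow up.
    reduction-encode : ∀ c → encode (Tᴾ c) ≡ reduction (encode c)
    reduction-encode c = trans encode-Tᴾ (cong (compCode 4 (encode tileOutputᴾ)) encode-arguments)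
      where
      arguments : Vec (PR 1) 4
      arguments = c ∷ c ∙ dropLastᴾ ∷ c ∙ upperWordᴾ ∷ π₀ ∷ []

      encode-Tᴾ : encode (Tᴾ c) ≡ compCode 4 (encode tileOutputᴾ) (encodeVec arguments)
      encode-Tᴾ = refl

      encode-arguments : encodeVec arguments ≡ consCode (encode c) (queriesCode (encode c))
      encode-arguments = refl

    reduction-code⁻¹ : ∀ (t : PR 1) e → encode t ≡ reduction e → Σ (PR 1) λ c → encode c ≡ e
    reduction-code⁻¹ t e eq =
      let _ , gs , _ , gs≡ = encode-comp⁻¹ {m = 4} t {encode tileOutputᴾ} {consCode e (queriesCode e)} eq
          c , _ , c≡ , _   = encodeVec-cons⁻¹ gs {e} {queriesCode e} gs≡
      in c , c≡

    queriesCodeᴾ : PR 1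
    queriesCodeᴾ = consCodeᴾ (compCodeᴾ 1 π₀ (consCodeᴾ (constᴾ (encode dropLastᴾ)) (constᴾ 0)))
                  (consCodeᴾ (compCodeᴾ 1 π₀ (consCodeᴾ (constᴾ (encode upperWordᴾ)) (constᴾ 0)))
                  (consCodeᴾ (constᴾ (encode (π₀ {0}))) (constᴾ 0)))

    queriesCodeᴾ⇓ : Computes₁ queriesCodeᴾ queriesCode
    queriesCodeᴾ⇓ e = consCodeᴾ⇓ (compCodeᴾ⇓ 1 ⇓P (consCodeᴾ⇓ (constᴾ⇓ (encode dropLastᴾ)) (constᴾ⇓ 0)))
                     (consCodeᴾ⇓ (compCodeᴾ⇓ 1 ⇓P (consCodeᴾ⇓ (constᴾ⇓ (encode upperWordᴾ)) (constᴾ⇓ 0)))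
                     (consCodeᴾ⇓ (constᴾ⇓ (encode (π₀ {0}))) (constᴾ⇓ 0)))

    reductionᴾ : PR 1
    reductionᴾ = compCodeᴾ 4 (constᴾ (encode tileOutputᴾ)) (consCodeᴾ π₀ queriesCodeᴾ)

    reductionᴾ⇓ : Computes₁ reductionᴾ reduction
    reductionᴾ⇓ e = compCodeᴾ⇓ 4 {a = encode tileOutputᴾ} {b = consCode e (queriesCode e)}
      (constᴾ⇓ (encode tileOutputᴾ)) (consCodeᴾ⇓ ⇓P (queriesCodeᴾ⇓ e))

    Tᴾ⇓ : ∀ {c x y₁ y₂ y₃} → c [ x ∷ [] ]⇓ y₁ → c [ dropLastCode x ∷ [] ]⇓ y₂ →
          c [ upperWord (decodeTile x) ∷ [] ]⇓ y₃ → Tᴾ c [ x ∷ [] ]⇓ tileOutput y₁ y₂ y₃ x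
    Tᴾ⇓ {x = x} c⇓₁ c⇓₂ c⇓₃ =
      ⇓comp (c⇓₁ ∷ ∙-⇓ (dropLastᴾ⇓ x) c⇓₂ ∷ ∙-⇓ (upperWordᴾ⇓ x) c⇓₃ ∷ ⇓P ∷ []) (tileOutputᴾ⇓ _ _ _ x)

    Tᴾ⇓⁻¹ : ∀ {c x v} → Tᴾ c [ x ∷ [] ]⇓ v → Trace c x v
    Tᴾ⇓⁻¹ {c} {x} (⇓comp (c⇓₁ ∷ ⇓comp (d⇓ ∷ []) c⇓₂ ∷ ⇓comp (w⇓ ∷ []) c⇓₃ ∷ ⇓P ∷ []) out⇓) = record
      { query₁ = c⇓₁
      ; query₂ = subst (λ z → c [ z ∷ [] ]⇓ _) (⇓-deterministic d⇓ (dropLastᴾ⇓ x)) c⇓₂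
      ; query₃ = subst (λ z → c [ z ∷ [] ]⇓ _) (⇓-deterministic w⇓ (upperWordᴾ⇓ x)) c⇓₃
      ; output = ⇓-deterministic out⇓ (tileOutputᴾ⇓ _ _ _ x)
      }

  IsTree-dropLastCode : ∀ {e x} → IsTree e → e ∋ₑ x → e ∋ₑ dropLastCode x
  IsTree-dropLastCode {e} {x} tree x∈e with ⌜⌝-initLast x
  ... | inj₁ x≡[]          = subst (e ∋ₑ_) (sym dropLastCode-x≡x) x∈e
    where
    dropLastCode-x≡x : dropLastCode x ≡ x
    dropLastCode-x≡x = trans (cong dropLastCode x≡[]) (trans dropLastCode-[] (sym x≡[]))
  ... | inj₂ (s , a , x≡) = subst (e ∋ₑ_) (sym (trans (cong dropLastCode x≡) (dropLastCode-∷ʳ s a)))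
    (tree (s ∷ʳ a) s (fromPointwise (≡⇒Pointwise-≡ refl) ++ᵖ (a ∷ [])) (subst (e ∋ₑ_) x≡ x∈e))

  module _ {e : ℕ} (c : PR 1) (c-code : encode c ≡ e) where

    private
      Tᴾ-code : encode (Tᴾ c) ≡ reduction e
      Tᴾ-code = trans (reduction-encode c) (cong reduction c-code)

      trace : ∀ {x v} → reduction e · x ⇓ v → Trace c x v
      trace = Tᴾ⇓⁻¹ ∘ Equivalence.to (·⇓⇔ (Tᴾ c) Tᴾ-code)

    reduction-member⇒valid : ∀ {t} → reduction e ∋ₑ ⌜ t ⌝ᵗ → ValidTile (e ∋ₑ_) t
    reduction-member⇒valid {t} t∈ = tileDefect-sound defect≡0 word∈e
      where
      open Trace (trace t∈)
      defect≡0 : tileDefect answer₃ t ≡ 0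
      defect≡0 = subst (λ t′ → tileDefect answer₃ t′ ≡ 0) (decodeTile-⌜⌝ᵗ t)
                   (tileOutput≡1⇒ answer₁ answer₂ answer₃ ⌜ t ⌝ᵗ (sym output))
      word∈e : answer₃ ≡ 1 → e ∋ₑ upperWord t
      word∈e answer≡1 = Equivalence.from (·⇓⇔ c c-code)
        (subst (λ t′ → c [ upperWord t′ ∷ [] ]⇓ 1) (decodeTile-⌜⌝ᵗ t) (⇓-resp-≡ answer≡1 query₃))

    private
      TreeLikeAt : ℕ → Set
      TreeLikeAt x = Σ ℕ λ y → c [ x ∷ [] ]⇓ y × (y ≡ 0 ⊎ y ≡ 1 × c [ dropLastCode x ∷ [] ]⇓ 1)

      Bit-trace : ∀ {x v} → Bit v → Trace c x v → TreeLikeAt x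
      Bit-trace {x} v-Bit tr = answer₁ , query₁ ,
        cases (sanityDefect-sound answer₁ answer₂ (tileOutput-Bit⇒ answer₁ answer₂ answer₃ x (subst Bit output v-Bit)))
        where
        open Trace tr
        cases : answer₁ ≡ 0 ⊎ answer₁ ≡ 1 × answer₂ ≡ 1 → answer₁ ≡ 0 ⊎ answer₁ ≡ 1 × c [ dropLastCode x ∷ [] ]⇓ 1
        cases (inj₁ answer≡0)               = inj₁ answer≡0
        cases (inj₂ (answer≡1 , answer₂≡1)) = inj₂ (answer≡1 , ⇓-resp-≡ answer₂≡1 query₂)

      reduction-tree-like : ∀ {x} → (reduction e · x ⇓ 0) ⊎ (reduction e · x ⇓ 1) → TreeLikeAt x
      reduction-tree-like (inj₁ x⇓0) = Bit-trace (inj₁ refl) (trace x⇓0)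
      reduction-tree-like (inj₂ x⇓1) = Bit-trace (inj₂ refl) (trace x⇓1)

    IsCharFn-reduction⇒ : IsCharFn (reduction e) → IsCharFn e
    IsCharFn-reduction⇒ char x with reduction-tree-like (char x)
    ... | _ , c⇓ , inj₁ refl       = inj₁ (c , c-code , c⇓)
    ... | _ , c⇓ , inj₂ (refl , _) = inj₂ (c , c-code , c⇓)

    IsCharFn-reduction⇒∷ʳ-closed : IsCharFn (reduction e) → ∀ s a → e ∋ₑ ⌜ s ∷ʳ a ⌝ → e ∋ₑ ⌜ s ⌝
    IsCharFn-reduction⇒∷ʳ-closed char s a s∷ʳa∈e with reduction-tree-like (char ⌜ s ∷ʳ a ⌝)
    ... | _ , c⇓ , inj₁ refl with () ← ⇓-deterministic c⇓ (Equivalence.to (·⇓⇔ c c-code) s∷ʳa∈e)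
    ... | _ , _  , inj₂ (_ , dropLast⇓1) =
      Equivalence.from (·⇓⇔ c c-code) (subst (λ z → c [ z ∷ [] ]⇓ 1) (dropLastCode-∷ʳ s a) dropLast⇓1)

    IsTiling⇒ValidTiling : ∀ τ → IsTiling (reduction e) τ → ValidTiling (e ∋ₑ_) τ
    IsTiling⇒ValidTiling τ τ-tiling = record
      { valid  = λ x y → reduction-member⇒valid (proj₁ (τ-tiling x y))
      ; matchH = λ x y → proj₁ (proj₂ (τ-tiling x y))
      ; matchV = λ x y → proj₂ (proj₂ (τ-tiling x y))
      }

    module _ (char : IsCharFn e) (tree : IsTree e) where

      private
        answer : ∀ x → Σ ℕ λ y → c [ x ∷ [] ]⇓ y × Bit y
        answer x with char x
        ... | inj₁ x⇓0 = 0 , Equivalence.to (·⇓⇔ c c-code) x⇓0 , inj₁ refl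
        ... | inj₂ x⇓1 = 1 , Equivalence.to (·⇓⇔ c c-code) x⇓1 , inj₂ refl

        χ : ℕ → ℕ
        χ x = proj₁ (answer x)

        χ⇓ : ∀ x → c [ x ∷ [] ]⇓ χ x
        χ⇓ x = proj₁ (proj₂ (answer x))

        ∈⇒χ≡1 : ∀ {x} → e ∋ₑ x → χ x ≡ 1
        ∈⇒χ≡1 {x} x∈e = ⇓-deterministic (χ⇓ x) (Equivalence.to (·⇓⇔ c c-code) x∈e)

        χ≡1⇒∈ : ∀ {x} → χ x ≡ 1 → e ∋ₑ x
        χ≡1⇒∈ {x} χ≡1 = Equivalence.from (·⇓⇔ c c-code) (⇓-resp-≡ χ≡1 (χ⇓ x))

        sane : ∀ x → sanityDefect (χ x) (χ (dropLastCode x)) ≡ 0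
        sane x = sanityDefect-complete (χ x) (χ (dropLastCode x)) (cases (proj₂ (proj₂ (answer x))))
          where
          cases : Bit (χ x) → χ x ≡ 0 ⊎ χ x ≡ 1 × χ (dropLastCode x) ≡ 1
          cases (inj₁ χ≡0) = inj₁ χ≡0
          cases (inj₂ χ≡1) = inj₂ (χ≡1 , ∈⇒χ≡1 (IsTree-dropLastCode tree (χ≡1⇒∈ χ≡1)))

        output : ℕ → ℕ
        output x = tileOutput (χ x) (χ (dropLastCode x)) (χ (upperWord (decodeTile x))) x

        run : ∀ x → Tᴾ c [ x ∷ [] ]⇓ output x
        run x = Tᴾ⇓ (χ⇓ x) (χ⇓ (dropLastCode x)) (χ⇓ (upperWord (decodeTile x)))

        reduction-·⇓ : ∀ {x v} → Tᴾ c [ x ∷ [] ]⇓ v → reduction e · x ⇓ v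
        reduction-·⇓ = Equivalence.from (·⇓⇔ (Tᴾ c) Tᴾ-code)

      IsCharFn-reduction : IsCharFn (reduction e)
      IsCharFn-reduction x with tileOutput-Bit (χ x) (χ (dropLastCode x)) (χ (upperWord (decodeTile x))) x (sane x)
      ... | inj₁ output≡0 = inj₁ (reduction-·⇓ (⇓-resp-≡ output≡0 (run x)))
      ... | inj₂ output≡1 = inj₂ (reduction-·⇓ (⇓-resp-≡ output≡1 (run x)))

      valid⇒reduction-member : ∀ {t} → ValidTile (e ∋ₑ_) t → reduction e ∋ₑ ⌜ t ⌝ᵗ
      valid⇒reduction-member {t} valid = reduction-·⇓ (⇓-resp-≡ output≡1 (run ⌜ t ⌝ᵗ))
        where
        defect≡0 : tileDefect (χ (upperWord (decodeTile ⌜ t ⌝ᵗ))) (decodeTile ⌜ t ⌝ᵗ) ≡ 0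
        defect≡0 = subst (λ t′ → tileDefect (χ (upperWord t′)) t′ ≡ 0) (sym (decodeTile-⌜⌝ᵗ t))
                     (tileDefect-complete valid ∈⇒χ≡1)
        output≡1 : output ⌜ t ⌝ᵗ ≡ 1
        output≡1 = tileOutput≡1 (χ ⌜ t ⌝ᵗ) (χ (dropLastCode ⌜ t ⌝ᵗ)) (χ (upperWord (decodeTile ⌜ t ⌝ᵗ))) ⌜ t ⌝ᵗ
                     (sane ⌜ t ⌝ᵗ) defect≡0

open Programs
open Tilings
open Reduction
open import Data.Nat using (zero; suc)
open import Data.List using (List; []; _∷_; _∷ʳ_; _++_; applyUpTo)
open import Data.List.Properties using (++-identityʳ; ++-assoc)
open import Data.List.Relation.Binary.Prefix.Heterogeneous using (Prefix; []; toView) renaming (_++_ to _++ᵛ_)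
open import Data.List.Relation.Binary.Pointwise using (Pointwise-≡⇒≡)
open import Data.Product using (Σ; _,_)
open import Data.Sum using (inj₁; inj₂)
open import Function using (mk⇔; _∘_)
open import Relation.Binary.PropositionalEquality

∷ʳ-closed⇒prefix-closed : ∀ {A : Set} (Q : List A → Set) → (∀ s a → Q (s ∷ʳ a) → Q s) →
                          ∀ {s t} → Prefix _≡_ t s → Q s → Q t
∷ʳ-closed⇒prefix-closed Q closed t≼s Qs with toView t≼s
... | _++ᵛ_ t≋u r = subst Q (sym (Pointwise-≡⇒≡ t≋u)) (++-closed _ r Qs)
  where
  ++-closed : ∀ t r → Q (t ++ r) → Q t
  ++-closed t []      Qt = subst Q (++-identityʳ t) Qt
  ++-closed t (a ∷ r) Qt = closed t a (++-closed (t ∷ʳ a) r (subst Q (sym (++-assoc t (a ∷ []) r)) Qt))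

IsCharFn⇒code : ∀ {e} → IsCharFn e → Σ (PR 1) λ c → encode c ≡ e
IsCharFn⇒code char with char 0
... | inj₁ (c , c-code , _) = c , c-code
... | inj₂ (c , c-code , _) = c , c-code

ILL⇒ATile : ∀ e → ILL e → ATile (reduction e)
ILL⇒ATile e (char , tree , p , p-path) =
  let c , c-code = IsCharFn⇒code char
      path-tiling : ValidTiling (e ∋ₑ_) (pathTiling p)
      path-tiling = pathTiling-valid (p-path ∘ suc)
  in IsCharFn-reduction c c-code char tree ,
     (pathTiling p , λ x y →
       valid⇒reduction-member c c-code char tree (ValidTiling.valid path-tiling x y) , refl , refl) ,
     λ τ τ-tiling → aperiodic (IsTiling⇒ValidTiling c c-code τ τ-tiling)

ATile⇒ILL : ∀ e → ATile (reduction e) → ILL e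
ATile⇒ILL e (char , (τ , τ-tiling) , _) =
  let c′ , c′-code = IsCharFn⇒code char
      c  , c-code  = reduction-code⁻¹ c′ e c′-code
      p  , p-path  = column-path (IsTiling⇒ValidTiling c c-code τ τ-tiling)
      tree : IsTree e
      tree s t = ∷ʳ-closed⇒prefix-closed (λ s → e ∋ₑ ⌜ s ⌝) (IsCharFn-reduction⇒∷ʳ-closed c c-code char)
  in IsCharFn-reduction⇒ c c-code char , tree , p , λ where
       zero    → tree (applyUpTo p 1) [] [] (p-path 0)
       (suc n) → p-path n

mainTheorem15 : ILL ≤ₘ ATile
mainTheorem15 = reduction , (encode reductionᴾ , λ n → reductionᴾ , refl , reductionᴾ⇓ n) ,
                λ e → mk⇔ (ILL⇒ATile e) (ATile⇒ILL e)
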